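{- Let $R_1\geq R_2\geq 1$ be integers and $T=(R_1-R_2)/2$. Then the union of the rectangles $R(\underline{a}/r,|r|^{ -1}\underline{\widehat{R}}^{ -1})$ over all triples $(r,(d,\underline c),\underline a)$ with $r\in\mathcal{O}$ monic, $|r|\le\widehat{R}_2$, $d\in\mathcal O$ monic with $d\mid r$, $\underline{c}$ primitive with $|dc_1|\le\widehat{T}|r|^{1/2}$ and $|dc_2|<\widehat{T}^{ -1}|r|^{1/2}$, and $\underline{a}\in\mathcal O^2$ with $|\underline{a}|<|r|$, $\gcd(a_1,a_2,r)=1$, $\underline{a}/r\in L(d\underline{c})$, is a disjoint union (rectangles for distinct triples are pairwise disjoint), and it equals the union of $R(\underline{a}/r,|r|^{ -1}\underline{\widehat{R}}^{ -1})$ over all monic $r$ with $|r|\le\widehat{R}_2$ and $\underline{a}$ with $|\underline{a}|<|r|$, $\gcd(a_1,a_2,r)=1$, which is also a disjoint union.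
   Context: $q$ a prime power, $K=\mathbb{F}_q(t)$, $\mathcal{O}=\mathbb{F}_q[t]$, $K_\infty=\mathbb{F}_q((t^{ -1}))$ with $|\alpha|=q^N$ for $\alpha=\sum_{i\le N}\alpha_it^i$, $\alpha_N\ne0$; vectors have max norm; $\mathbb{T}=\{|\alpha|<1\}$; $\widehat{R}=q^R$. $\underline{c}\in\mathcal{O}^2$ is primitive if $\gcd(c_1,c_2)=1$ and either $c_1$ is monic or $c_1=0$ and $c_2$ is monic. $L(d\underline{c})$ is the set of $\underline{x}\in\mathbb{T}^2\cap K^2$ with $d\underline{c}\cdot\underline{x}=k$ for some $k\in\mathcal{O}$ with $\gcd(k,d)=1$. $R(\underline{x},(\rho_1,\rho_2))=\{\underline{\theta}\in\mathbb{T}^2:|\theta_i-x_i|<\rho_i,\ i=1,2\}$ and $|r|^{ -1}\underline{\widehat{R}}^{ -1}=(|r|^{ -1}\widehat{R}_1^{ -1},|r|^{ -1}\widehat{R}_2^{ -1})$. -}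

module Defs where

open import Level using (0ℓ)
open import Data.Nat using (ℕ; zero; suc; _≤_; _<_) renaming (_+_ to _+ℕ_; _*_ to _*ℕ_)
open import Data.Fin using (Fin)
open import Data.List using (List; []; _∷_; map)
open import Data.Product using (Σ; _×_; _,_)
open import Data.Sum using (_⊎_)
open import Relation.Binary.PropositionalEquality using (_≡_; _≢_)
open import Relation.Nullary using (¬_)
open import Algebra.Structures using (IsCommutativeRing)
open import Function.Bundles using (_↔_; _⇔_)

-- A finite field F_q (q = size; any finite field has prime-power order).
-- Equality on the carrier is propositional equality.

record FiniteField : Set₁ where
  infixl 7 _*_
  infixl 6 _+_
  field
    Carrier    : Set
    _+_ _*_    : Carrier → Carrier → Carrier
    -_         : Carrier → Carrier
    0# 1#      : Carrier
    isCommutativeRing : IsCommutativeRing _≡_ _+_ _*_ -_ 0# 1#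
    0≢1        : 0# ≢ 1#
    inverse    : (x : Carrier) → x ≢ 0# → Σ Carrier (λ y → x * y ≡ 1#)
    size       : ℕ
    finite     : Carrier ↔ Fin size

module Over (F : FiniteField) where
  open FiniteField F

  -- Polynomials in O = F_q[t]: coefficient lists, lowest degree first.
  -- Equality of polynomials is coefficientwise (trailing zeros irrelevant).
  Poly : Set
  Poly = List Carrier

  coeff : Poly → ℕ → Carrier
  coeff []       _       = 0#
  coeff (x ∷ p)  zero    = x
  coeff (x ∷ p)  (suc n) = coeff p n

  _≈P_ : Poly → Poly → Set
  p ≈P q = ∀ n → coeff p n ≡ coeff q n

  infixl 7 _*P_
  infixl 6 _+P_ _-P_

  _+P_ : Poly → Poly → Poly
  []      +P q       = q
  (x ∷ p) +P []      = x ∷ p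
  (x ∷ p) +P (y ∷ q) = (x + y) ∷ (p +P q)

  scale : Carrier → Poly → Poly
  scale c p = map (c *_) p

  _-P_ : Poly → Poly → Poly
  p -P q = p +P map -_ q

  shift : Poly → Poly
  shift p = 0# ∷ p

  _*P_ : Poly → Poly → Poly
  []      *P q = []
  (x ∷ p) *P q = scale x q +P shift (p *P q)

  1P : Poly
  1P = 1# ∷ []

  IsZero : Poly → Set
  IsZero p = ∀ m → coeff p m ≡ 0#

  MonicDeg : Poly → ℕ → Set
  MonicDeg p n = coeff p n ≡ 1# × (∀ m → n < m → coeff p m ≡ 0#)

  IsMonic : Poly → Set
  IsMonic p = Σ ℕ (λ n → MonicDeg p n)

  -- |p| < q^n
  AbsLt : Poly → ℕ → Set
  AbsLt p n = ∀ m → n ≤ m → coeff p m ≡ 0#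

  _∣P_ : Poly → Poly → Set
  e ∣P p = Σ Poly (λ m → (e *P m) ≈P p)

  Coprime : Poly → Poly → Set
  Coprime a b = ∀ e → e ∣P a → e ∣P b → e ∣P 1P

  Coprime3 : Poly → Poly → Poly → Set
  Coprime3 a b c = ∀ e → e ∣P a → e ∣P b → e ∣P c → e ∣P 1P

  Primitive : Poly → Poly → Set
  Primitive c₁ c₂ = Coprime c₁ c₂ × (IsMonic c₁ ⊎ (IsZero c₁ × IsMonic c₂))

  -- Laurent expansion of a/r in T = {|α|<1}, for r monic of degree n and
  -- |a| < |r|:  a/r = Σ_{j≥0} digit a r n j · t^{-(j+1)}  (long division).

  remainder : Poly → Poly → ℕ → ℕ → Poly
  remainder a r n zero    = a
  remainder a r n (suc j) =
    shift (remainder a r n j) -P scale (coeff (shift (remainder a r n j)) n) r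

  digit : Poly → Poly → ℕ → ℕ → Carrier
  digit a r n j = coeff (shift (remainder a r n j)) n

  -- An element θ of T is given by its digits: θ = Σ_{j≥0} θ j · t^{-(j+1)}.
  𝕋 : Set
  𝕋 = ℕ → Carrier

  -- |θ - a/r| < q^{-M}  (r monic of degree n, |a|<|r|): first M digits agree.
  Close : 𝕋 → Poly → Poly → ℕ → ℕ → Set
  Close θ a r n M = ∀ j → j < M → θ j ≡ digit a r n j

  -- θ ∈ R(a/r, |r|^{-1} (q^{-R₁}, q^{-R₂})), where n = deg r.
  InRect : ℕ → ℕ → (𝕋 × 𝕋) → Poly → Poly → Poly → ℕ → Set
  InRect R₁ R₂ (θ₁ , θ₂) a₁ a₂ r n =
    Close θ₁ a₁ r n (n +ℕ R₁) × Close θ₂ a₂ r n (n +ℕ R₂)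

  -- Family 1: triples (r,(d,c),a); the field deg records n = deg r.

  record Index₁ : Set where
    constructor idx₁
    field
      r   : Poly
      deg : ℕ
      d c₁ c₂ a₁ a₂ : Poly

  -- a/r ∈ L(d c): d c·(a/r) = k ∈ O with gcd(k,d) = 1
  InL : Poly → Poly → Poly → Poly → Poly → Poly → Set
  InL d c₁ c₂ a₁ a₂ r =
    Σ Poly (λ k → (r *P k) ≈P (d *P ((c₁ *P a₁) +P (c₂ *P a₂))) × Coprime k d)

  -- conditions on a triple, for R₁, R₂ given.
  -- |d c₁| ≤ T̂ |r|^{1/2}  ⇔  |d c₁|² ≤ q^{R₁-R₂} q^{deg r}
  -- |d c₂| < T̂^{-1} |r|^{1/2}  ⇔  |d c₂|² < q^{R₂-R₁} q^{deg r}
  Admissible₁ : ℕ → ℕ → Index₁ → Set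
  Admissible₁ R₁ R₂ (idx₁ r n d c₁ c₂ a₁ a₂) =
    MonicDeg r n × n ≤ R₂ ×
    IsMonic d × d ∣P r ×
    Primitive c₁ c₂ ×
    (∀ m → R₁ +ℕ n < R₂ +ℕ 2 *ℕ m → coeff (d *P c₁) m ≡ 0#) ×
    (∀ m → R₂ +ℕ n ≤ R₁ +ℕ 2 *ℕ m → coeff (d *P c₂) m ≡ 0#) ×
    AbsLt a₁ n × AbsLt a₂ n × Coprime3 a₁ a₂ r ×
    InL d c₁ c₂ a₁ a₂ r

  SameIndex₁ : Index₁ → Index₁ → Set
  SameIndex₁ (idx₁ r _ d c₁ c₂ a₁ a₂) (idx₁ r' _ d' c₁' c₂' a₁' a₂') =
    r ≈P r' × d ≈P d' × c₁ ≈P c₁' × c₂ ≈P c₂' × a₁ ≈P a₁' × a₂ ≈P a₂'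

  InRect₁ : ℕ → ℕ → (𝕋 × 𝕋) → Index₁ → Set
  InRect₁ R₁ R₂ θ (idx₁ r n _ _ _ a₁ a₂) = InRect R₁ R₂ θ a₁ a₂ r n

  Union₁ : ℕ → ℕ → (𝕋 × 𝕋) → Set
  Union₁ R₁ R₂ θ = Σ Index₁ (λ i → Admissible₁ R₁ R₂ i × InRect₁ R₁ R₂ θ i)

  Disjoint₁ : ℕ → ℕ → Set
  Disjoint₁ R₁ R₂ = ∀ i i' → Admissible₁ R₁ R₂ i → Admissible₁ R₁ R₂ i' →
    ¬ SameIndex₁ i i' → ∀ θ → ¬ (InRect₁ R₁ R₂ θ i × InRect₁ R₁ R₂ θ i')

  record Index₂ : Set where
    constructor idx₂
    field
      r   : Poly
      deg : ℕ
      a₁ a₂ : Poly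

  Admissible₂ : ℕ → Index₂ → Set
  Admissible₂ R₂ (idx₂ r n a₁ a₂) =
    MonicDeg r n × n ≤ R₂ × AbsLt a₁ n × AbsLt a₂ n × Coprime3 a₁ a₂ r

  SameIndex₂ : Index₂ → Index₂ → Set
  SameIndex₂ (idx₂ r _ a₁ a₂) (idx₂ r' _ a₁' a₂') = r ≈P r' × a₁ ≈P a₁' × a₂ ≈P a₂'

  InRect₂ : ℕ → ℕ → (𝕋 × 𝕋) → Index₂ → Set
  InRect₂ R₁ R₂ θ (idx₂ r n a₁ a₂) = InRect R₁ R₂ θ a₁ a₂ r n

  Union₂ : ℕ → ℕ → (𝕋 × 𝕋) → Set
  Union₂ R₁ R₂ θ = Σ Index₂ (λ i → Admissible₂ R₂ i × InRect₂ R₁ R₂ θ i)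

  Disjoint₂ : ℕ → ℕ → Set
  Disjoint₂ R₁ R₂ = ∀ i i' → Admissible₂ R₂ i → Admissible₂ R₂ i' →
    ¬ SameIndex₂ i i' → ∀ θ → ¬ (InRect₂ R₁ R₂ θ i × InRect₂ R₁ R₂ θ i')

-- Rectangles around fractions a/r and a′/r′ with |r|, |r′| ≤ R̂₂ ≤ R̂₁ share a point only if the
-- first deg r + deg r′ Laurent digits of a/r and a′/r′ agree; then t^N (a r′ − a′ r) has degree < N, so
-- a r′ = a′ r, and coprimality gives (r, a) = (r′, a′). The rest of a triple is determined by (r, a):
-- the vectors d c and d′ c′ are both orthogonal to a modulo r and short in the two directions, so their
-- determinant is a multiple of r of degree < deg r, hence zero; primitivity and lowest terms then force
-- c = c′ and d = d′. Conversely every (r, a) has such a triple: the q^(A+B) > q^(deg r) short vectors v give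
-- two with equal v·a mod r, whose difference is short with r ∣ v·a; writing v = h c with c primitive and
-- d the reduced denominator of c·a / r, d divides h, so d c is as short as v.

module Submission where

open import Defs
open import Algebra.Bundles using (CommutativeRing)
open import Data.Nat using (ℕ; _≤_)
open import Data.Fin.Base using (Fin)
open import Data.Product using (_×_; _,_)
open import Function.Bundles using (_⇔_; _↔_)

module Exponents where

  open import Data.Nat.Base using (ℕ; suc; _+_; _*_; _∸_; _≤_; _<_; s≤s; ⌊_/2⌋; ⌈_/2⌉)
  open import Data.Nat.Properties
  open import Relation.Binary.PropositionalEquality
  import Data.Nat.Solver
  open Data.Nat.Solver.+-*-Solver using (solve; _:+_; _:*_; _:=_; con)

  -- Sizes |v₁| < q^A and |v₂| < q^B of the short vector; A + B > n makes the pigeonhole argument work.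
  record ExponentSplit (R₁ R₂ n : ℕ) : Set where
    field
      A B     : ℕ
      n<A+B   : n < A + B
      A-short : ∀ m → R₁ + n < R₂ + 2 * m → A ≤ m
      B-short : ∀ m → R₂ + n ≤ R₁ + 2 * m → B ≤ m

  exponentSplit : ∀ {R₁ R₂} n → R₂ ≤ R₁ → ExponentSplit R₁ R₂ n
  exponentSplit {R₁} {R₂} n R₂≤R₁ = record
    { A = suc h ; B = n ∸ h ; n<A+B = s≤s (m≤n+m∸n n h) ; A-short = A-short ; B-short = B-short }
    where
    X = (R₁ ∸ R₂) + n
    h = ⌊ X /2⌋
    R₂+X≡R₁+n : R₂ + X ≡ R₁ + n
    R₂+X≡R₁+n = trans (sym (+-assoc R₂ (R₁ ∸ R₂) n)) (cong (_+ n) (m+[n∸m]≡n R₂≤R₁))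
    2h≤X : 2 * h ≤ X
    2h≤X = begin
      2 * h        ≡⟨ cong (h +_) (+-identityʳ h) ⟩
      h + h        ≤⟨ +-monoʳ-≤ h (⌊n/2⌋≤⌈n/2⌉ X) ⟩
      h + ⌈ X /2⌉  ≡⟨ ⌊n/2⌋+⌈n/2⌉≡n X ⟩
      X            ∎
      where open ≤-Reasoning
    X≤2h+1 : X ≤ suc (2 * h)
    X≤2h+1 = begin
      X            ≡⟨ sym (⌊n/2⌋+⌈n/2⌉≡n X) ⟩
      h + ⌈ X /2⌉  ≤⟨ +-monoʳ-≤ h (⌊n/2⌋-mono (n≤1+n (suc X))) ⟩
      h + suc h    ≡⟨ solve 1 (λ h → h :+ (con 1 :+ h) := con 1 :+ con 2 :* h) refl h ⟩
      suc (2 * h)  ∎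
      where open ≤-Reasoning
    A-short : ∀ m → R₁ + n < R₂ + 2 * m → suc h ≤ m
    A-short m R₁+n<R₂+2m = *-cancelˡ-< 2 h m (+-cancelˡ-< R₂ (2 * h) (2 * m) (begin-strict
      R₂ + 2 * h  ≤⟨ +-monoʳ-≤ R₂ 2h≤X ⟩
      R₂ + X      ≡⟨ R₂+X≡R₁+n ⟩
      R₁ + n      <⟨ R₁+n<R₂+2m ⟩
      R₂ + 2 * m  ∎))
      where open ≤-Reasoning
    B-short : ∀ m → R₂ + n ≤ R₁ + 2 * m → n ∸ h ≤ m
    B-short m R₂+n≤R₁+2m = m≤n+o⇒m∸n≤o n h (≤-pred (*-cancelˡ-< 2 n (suc (h + m)) (+-cancelˡ-< (R₁ + R₂) _ _ (begin-strict
      (R₁ + R₂) + 2 * n                   ≡⟨ solve 3 (λ R₁ R₂ n → (R₁ :+ R₂) :+ con 2 :* n := (R₂ :+ n) :+ (R₁ :+ n)) refl R₁ R₂ n ⟩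
      (R₂ + n) + (R₁ + n)                 ≤⟨ +-mono-≤ R₂+n≤R₁+2m (≤-trans (≤-reflexive (sym R₂+X≡R₁+n)) (+-monoʳ-≤ R₂ X≤2h+1)) ⟩
      (R₁ + 2 * m) + (R₂ + suc (2 * h))   <⟨ n<1+n _ ⟩
      suc ((R₁ + 2 * m) + (R₂ + suc (2 * h)))
        ≡⟨ solve 4 (λ R₁ R₂ m h → con 1 :+ ((R₁ :+ con 2 :* m) :+ (R₂ :+ (con 1 :+ con 2 :* h)))
                    := (R₁ :+ R₂) :+ con 2 :* (con 1 :+ (h :+ m))) refl R₁ R₂ m h ⟩
      (R₁ + R₂) + 2 * suc (h + m)         ∎))))
      where open ≤-Reasoning


module RingDivisibility {c ℓ} (R : CommutativeRing c ℓ) where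

  import Algebra.Properties.Ring as RingProperties
  import Algebra.Solver.Ring.NaturalCoefficients.Default as NatSolver

  open CommutativeRing R
  open RingProperties ring using (-‿distribʳ-*; [y-z]x≈yx-zx; -‿+-comm)
  open import Algebra.Properties.Semiring.Divisibility semiring public
    using (_∣ˡ_; _,_; ∣ˡ-refl; ∣ˡ-trans; ∣ˡ-respʳ-≈; x∣ˡy⇒x∣ˡyz; x∣ˡxy)
  open NatSolver commutativeSemiring using (solve; _:+_; _:*_; _:=_)
  open import Relation.Binary.Reasoning.Setoid setoid

  ∣ˡ-+ : ∀ {x y z} → x ∣ˡ y → x ∣ˡ z → x ∣ˡ y + z
  ∣ˡ-+ {x} (p , xp≈y) (q , xq≈z) = p + q , trans (distribˡ x p q) (+-cong xp≈y xq≈z)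

  ∣ˡ-‿ : ∀ {x y} → x ∣ˡ y → x ∣ˡ - y
  ∣ˡ-‿ {x} (p , xp≈y) = - p , trans (sym (-‿distribʳ-* x p)) (-‿cong xp≈y)

  x∣ˡy⇒x∣ˡzy : ∀ {x y} z → x ∣ˡ y → x ∣ˡ z * y
  x∣ˡy⇒x∣ˡzy {y = y} z x∣ˡy = ∣ˡ-respʳ-≈ (*-comm y z) (x∣ˡy⇒x∣ˡyz z x∣ˡy)

  ∣ˡ-linear : ∀ {x a b} u v → x ∣ˡ a → x ∣ˡ b → x ∣ˡ u * a + v * b
  ∣ˡ-linear u v x∣ˡa x∣ˡb = ∣ˡ-+ (x∣ˡy⇒x∣ˡzy u x∣ˡa) (x∣ˡy⇒x∣ˡzy v x∣ˡb)

  -- The hypothesis is arranged without subtraction so that, in applications, it is a semiring identity.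
  +-swap⇒-≈ : ∀ {x y p q} → x + p ≈ q + y → x - y ≈ q - p
  +-swap⇒-≈ {x} {y} {p} {q} x+p≈q+y = begin
    x - y                  ≈⟨ sym (+-identityʳ _) ⟩
    (x - y) + 0#           ≈⟨ +-congˡ (sym (-‿inverseʳ p)) ⟩
    (x - y) + (p - p)      ≈⟨ solve 4 (λ x y′ p p′ → (x :+ y′) :+ (p :+ p′) := (x :+ p) :+ (y′ :+ p′)) refl x (- y) p (- p) ⟩
    (x + p) + (- y - p)    ≈⟨ +-congʳ x+p≈q+y ⟩
    (q + y) + (- y - p)    ≈⟨ solve 4 (λ q y y′ p′ → (q :+ y) :+ (y′ :+ p′) := (q :+ p′) :+ (y :+ y′)) refl q y (- y) (- p) ⟩
    (q - p) + (y - y)      ≈⟨ +-congˡ (-‿inverseʳ y) ⟩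
    (q - p) + 0#           ≈⟨ +-identityʳ _ ⟩
    q - p                  ∎

  ∣ˡ-difference : ∀ {r x y p q} → x + p ≈ q + y → r ∣ˡ p → r ∣ˡ q → r ∣ˡ x - y
  ∣ˡ-difference x+p≈q+y r∣ˡp r∣ˡq = ∣ˡ-respʳ-≈ (sym (+-swap⇒-≈ x+p≈q+y)) (∣ˡ-+ r∣ˡq (∣ˡ-‿ r∣ˡp))

  bezout⇒∣ˡ-cancel : ∀ {a b x u v} → u * a + v * b ≈ 1# → a ∣ˡ b * x → a ∣ˡ x
  bezout⇒∣ˡ-cancel {a} {b} {x} {u} {v} bezout a∣ˡbx = ∣ˡ-respʳ-≈ combination≈x (∣ˡ-linear (u * x) v (∣ˡ-refl {a}) a∣ˡbx)
    where
    combination≈x : (u * x) * a + v * (b * x) ≈ x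
    combination≈x = begin
      (u * x) * a + v * (b * x)  ≈⟨ solve 5 (λ u x a v b → (u :* x) :* a :+ v :* (b :* x) := (u :* a :+ v :* b) :* x) refl u x a v b ⟩
      (u * a + v * b) * x        ≈⟨ *-congʳ bezout ⟩
      1# * x                     ≈⟨ *-identityˡ x ⟩
      x                          ∎

  bezout₃⇒∣ˡ-cancel : ∀ {a₁ a₂ r x u v w} → u * a₁ + v * a₂ + w * r ≈ 1# → r ∣ˡ x * a₁ → r ∣ˡ x * a₂ → r ∣ˡ x
  bezout₃⇒∣ˡ-cancel {a₁} {a₂} {r} {x} {u} {v} {w} bezout r∣ˡxa₁ r∣ˡxa₂ =
    ∣ˡ-respʳ-≈ combination≈x (∣ˡ-+ (∣ˡ-linear u v r∣ˡxa₁ r∣ˡxa₂) (x∣ˡy⇒x∣ˡzy (w * x) (∣ˡ-refl {r})))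
    where
    combination≈x : u * (x * a₁) + v * (x * a₂) + (w * x) * r ≈ x
    combination≈x = begin
      u * (x * a₁) + v * (x * a₂) + (w * x) * r  ≈⟨ solve 7 (λ u x a₁ v a₂ w r → u :* (x :* a₁) :+ v :* (x :* a₂) :+ (w :* x) :* r
                                                             := (u :* a₁ :+ v :* a₂ :+ w :* r) :* x) refl u x a₁ v a₂ w r ⟩
      (u * a₁ + v * a₂ + w * r) * x              ≈⟨ *-congʳ bezout ⟩
      1# * x                                     ≈⟨ *-identityˡ x ⟩
      x                                          ∎

  bezout₃⇒∣ˡ-det : ∀ {a₁ a₂ r u v w v₁ v₂ w₁ w₂} → u * a₁ + v * a₂ + w * r ≈ 1# →
                   r ∣ˡ v₁ * a₁ + v₂ * a₂ → r ∣ˡ w₁ * a₁ + w₂ * a₂ → r ∣ˡ v₁ * w₂ - v₂ * w₁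
  bezout₃⇒∣ˡ-det {a₁} {a₂} {r} {u} {v} {w} {v₁} {v₂} {w₁} {w₂} bezout r∣ˡv·a r∣ˡw·a =
    bezout₃⇒∣ˡ-cancel bezout (∣ˡ-respʳ-≈ (sym ([y-z]x≈yx-zx a₁ _ _)) det·a₁) (∣ˡ-respʳ-≈ (sym ([y-z]x≈yx-zx a₂ _ _)) det·a₂)
    where
    det·a₁ : r ∣ˡ (v₁ * w₂) * a₁ - (v₂ * w₁) * a₁
    det·a₁ = ∣ˡ-difference
      (solve 6 (λ v₁ v₂ w₁ w₂ a₁ a₂ → (v₁ :* w₂) :* a₁ :+ v₂ :* (w₁ :* a₁ :+ w₂ :* a₂)
                := w₂ :* (v₁ :* a₁ :+ v₂ :* a₂) :+ (v₂ :* w₁) :* a₁) refl v₁ v₂ w₁ w₂ a₁ a₂)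
      (x∣ˡy⇒x∣ˡzy v₂ r∣ˡw·a) (x∣ˡy⇒x∣ˡzy w₂ r∣ˡv·a)
    det·a₂ : r ∣ˡ (v₁ * w₂) * a₂ - (v₂ * w₁) * a₂
    det·a₂ = ∣ˡ-difference
      (solve 6 (λ v₁ v₂ w₁ w₂ a₁ a₂ → (v₁ :* w₂) :* a₂ :+ w₁ :* (v₁ :* a₁ :+ v₂ :* a₂)
                := v₁ :* (w₁ :* a₁ :+ w₂ :* a₂) :+ (v₂ :* w₁) :* a₂) refl v₁ v₂ w₁ w₂ a₁ a₂)
      (x∣ˡy⇒x∣ˡzy w₁ r∣ˡv·a) (x∣ˡy⇒x∣ˡzy v₁ r∣ˡw·a)

  bezout-division-step : ∀ {a b q ρ g u v} → a ≈ b * q + ρ → g ≈ u * b + v * ρ → g ≈ v * a + (u - v * q) * b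
  bezout-division-step {a} {b} {q} {ρ} {g} {u} {v} a≈bq+ρ g≈ub+vρ = begin
    g                                       ≈⟨ g≈ub+vρ ⟩
    u * b + v * ρ                           ≈⟨ sym (+-identityʳ _) ⟩
    (u * b + v * ρ) + 0#                    ≈⟨ +-congˡ (sym (-‿inverseʳ ((v * q) * b))) ⟩
    (u * b + v * ρ) + ((v * q) * b - (v * q) * b)
      ≈⟨ solve 6 (λ u b v ρ q N → (u :* b :+ v :* ρ) :+ ((v :* q) :* b :+ N)
                  := v :* (b :* q :+ ρ) :+ (u :* b :+ N)) refl u b v ρ q (- ((v * q) * b)) ⟩
    v * (b * q + ρ) + (u * b - (v * q) * b) ≈⟨ +-cong (*-congˡ (sym a≈bq+ρ)) (sym ([y-z]x≈yx-zx b u (v * q))) ⟩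
    v * a + (u - v * q) * b                 ∎

  linear-difference : ∀ x₁ y₁ x₂ y₂ a b → (x₁ - y₁) * a + (x₂ - y₂) * b ≈ (x₁ * a + x₂ * b) - (y₁ * a + y₂ * b)
  linear-difference x₁ y₁ x₂ y₂ a b = begin
    (x₁ - y₁) * a + (x₂ - y₂) * b                  ≈⟨ +-cong ([y-z]x≈yx-zx a x₁ y₁) ([y-z]x≈yx-zx b x₂ y₂) ⟩
    (x₁ * a - y₁ * a) + (x₂ * b - y₂ * b)          ≈⟨ solve 4 (λ p q′ s t′ → (p :+ q′) :+ (s :+ t′)
                                                               := (p :+ s) :+ (q′ :+ t′)) refl (x₁ * a) (- (y₁ * a)) (x₂ * b) (- (y₂ * b)) ⟩
    (x₁ * a + x₂ * b) + (- (y₁ * a) - (y₂ * b))    ≈⟨ +-congˡ (-‿+-comm (y₁ * a) (y₂ * b)) ⟩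
    (x₁ * a + x₂ * b) - (y₁ * a + y₂ * b)          ∎


module VecPigeonhole {C : Set} {s : ℕ} (finite : C ↔ Fin s) where

  open import Data.Nat.Base using (zero; suc; _^_; _<_; s<s; z<s)
  import Data.Nat.Properties as ℕ
  open import Data.Fin.Base using (zero; suc; combine; remQuot)
  import Data.Fin.Properties as Fin
  open import Data.Vec.Base using (Vec; []; _∷_)
  open import Data.Product.Base using (∃₂; _×_; _,_; proj₁; proj₂)
  open import Data.Empty using (⊥-elim)
  open import Function.Bundles using (Inverse; Injection)
  open import Function.Properties.Inverse using (↔⇒↣)
  open import Relation.Binary.PropositionalEquality

  private
    to = Inverse.to finite
    from = Inverse.from finite

  encode : ∀ k → Vec C k → Fin (s ^ k)
  encode zero    []      = zero
  encode (suc k) (x ∷ v) = combine (to x) (encode k v)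

  decode : ∀ k → Fin (s ^ k) → Vec C k
  decode zero    _ = []
  decode (suc k) i = from (proj₁ (remQuot {s} (s ^ k) i)) ∷ decode k (proj₂ (remQuot {s} (s ^ k) i))

  decode-encode : ∀ k v → decode k (encode k v) ≡ v
  decode-encode zero    []      = refl
  decode-encode (suc k) (x ∷ v) = cong₂ _∷_
    (trans (cong (λ p → from (proj₁ p)) split) (Inverse.strictlyInverseʳ finite x))
    (trans (cong (λ p → decode k (proj₂ p)) split) (decode-encode k v))
    where
    split = Fin.remQuot-combine {s} {s ^ k} (to x) (encode k v)

  encode-decode : ∀ k i → encode k (decode k i) ≡ i
  encode-decode zero    zero = refl
  encode-decode (suc k) i =
    trans (cong₂ combine (Inverse.strictlyInverseˡ finite _) (encode-decode k _)) (Fin.combine-remQuot {s} (s ^ k) i)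

  distinct⇒1<size : ∀ {x y : C} → x ≢ y → 1 < s
  distinct⇒1<size {x} {y} x≢y = distinct-Fin (to x) (to y) (λ eq → x≢y (Injection.injective (↔⇒↣ finite) eq))
    where
    distinct-Fin : ∀ {k} (i j : Fin k) → i ≢ j → 1 < k
    distinct-Fin {suc (suc _)} _    _    _    = s<s z<s
    distinct-Fin {suc zero}    zero zero i≢j = ⊥-elim (i≢j refl)

  vec-pigeonhole : ∀ {m n} → 1 < s → n < m → (f : Vec C m → Vec C n) → ∃₂ λ x y → x ≢ y × f x ≡ f y
  vec-pigeonhole {m} {n} 1<s n<m f with Fin.pigeonhole (ℕ.^-monoʳ-< s 1<s n<m) (λ i → encode n (f (decode m i)))
  ... | i , j , i<j , fi≡fj =
    decode m i , decode m j ,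
    (λ eq → Fin.<⇒≢ i<j (trans (sym (encode-decode m i)) (trans (cong (encode m) eq) (encode-decode m j)))) ,
    trans (sym (decode-encode n _)) (trans (cong (decode n) fi≡fj) (decode-encode n _))


module PolynomialRing (F : FiniteField) where

  open import Level using (0ℓ)
  open import Algebra.Structures using (IsCommutativeRing)
  open import Data.Nat.Base using (zero; suc)
  open import Data.List.Base using ([]; _∷_; map)
  open import Data.Product.Base using (_,_)
  open import Relation.Binary.PropositionalEquality
  import Algebra.Properties.Ring as RingProperties
  import Algebra.Solver.Ring.NaturalCoefficients.Default as NatSolver

  open FiniteField F
  open Over F
  open ≡-Reasoning

  coefficientRing : CommutativeRing 0ℓ 0ℓ
  coefficientRing = record { isCommutativeRing = isCommutativeRing }

  open CommutativeRing coefficientRing public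
    using (+-identityˡ; +-identityʳ; *-identityˡ; *-identityʳ; zeroˡ; zeroʳ; -‿inverseʳ; *-assoc; *-comm)
  open RingProperties (CommutativeRing.ring coefficientRing) public
    using (-0#≈0#)
  module 𝔽-Solver = NatSolver (CommutativeRing.commutativeSemiring coefficientRing)
  open 𝔽-Solver using (_:+_; _:*_; _:=_)

  negate : Poly → Poly
  negate = map -_

  coeff-+ : ∀ p q m → coeff (p +P q) m ≡ coeff p m + coeff q m
  coeff-+ []      q       m       = sym (+-identityˡ _)
  coeff-+ (x ∷ p) []      m       = sym (+-identityʳ _)
  coeff-+ (x ∷ p) (y ∷ q) zero    = refl
  coeff-+ (x ∷ p) (y ∷ q) (suc m) = coeff-+ p q m

  coeff-negate : ∀ p m → coeff (negate p) m ≡ - coeff p m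
  coeff-negate []      m       = sym -0#≈0#
  coeff-negate (x ∷ p) zero    = refl
  coeff-negate (x ∷ p) (suc m) = coeff-negate p m

  coeff-scale : ∀ c p m → coeff (scale c p) m ≡ c * coeff p m
  coeff-scale c []      m       = sym (zeroʳ c)
  coeff-scale c (x ∷ p) zero    = refl
  coeff-scale c (x ∷ p) (suc m) = coeff-scale c p m

  coeff-- : ∀ p q m → coeff (p -P q) m ≡ coeff p m + - coeff q m
  coeff-- p q m = trans (coeff-+ p (negate q) m) (cong (coeff p m +_) (coeff-negate q m))

  coeff-∷* : ∀ x p q m → coeff ((x ∷ p) *P q) m ≡ x * coeff q m + coeff (shift (p *P q)) m
  coeff-∷* x p q m = trans (coeff-+ (scale x q) (shift (p *P q)) m) (cong (_+ coeff (shift (p *P q)) m) (coeff-scale x q m))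

  -- Coefficientwise equality wrapped in a record, so that both polynomials can be inferred.
  infix 4 _≈_
  record _≈_ (p q : Poly) : Set where
    constructor mk≈
    field ≈⇒≈P : p ≈P q
  open _≈_ public

  ≈-refl : ∀ {p} → p ≈ p
  ≈-refl = mk≈ λ _ → refl

  ≈-sym : ∀ {p q} → p ≈ q → q ≈ p
  ≈-sym (mk≈ e) = mk≈ λ m → sym (e m)

  ≈-trans : ∀ {p q s} → p ≈ q → q ≈ s → p ≈ s
  ≈-trans (mk≈ e) (mk≈ f) = mk≈ λ m → trans (e m) (f m)

  +P-cong : ∀ {p p′ q q′} → p ≈ p′ → q ≈ q′ → p +P q ≈ p′ +P q′
  +P-cong {p} {p′} {q} {q′} (mk≈ e) (mk≈ f) =
    mk≈ λ m → trans (coeff-+ p q m) (trans (cong₂ _+_ (e m) (f m)) (sym (coeff-+ p′ q′ m)))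

  negate-cong : ∀ {p p′} → p ≈ p′ → negate p ≈ negate p′
  negate-cong {p} {p′} (mk≈ e) = mk≈ λ m → trans (coeff-negate p m) (trans (cong -_ (e m)) (sym (coeff-negate p′ m)))

  scale-cong : ∀ c {p p′} → p ≈ p′ → scale c p ≈ scale c p′
  scale-cong c {p} {p′} (mk≈ e) = mk≈ λ m → trans (coeff-scale c p m) (trans (cong (c *_) (e m)) (sym (coeff-scale c p′ m)))

  shift-cong : ∀ {p p′} → p ≈ p′ → shift p ≈ shift p′
  shift-cong (mk≈ e) = mk≈ λ { zero → refl ; (suc m) → e m }

  IsZero-*P : ∀ p q → IsZero p → IsZero (p *P q)
  IsZero-*P []      q z m = refl
  IsZero-*P (x ∷ p) q z m = begin
    coeff ((x ∷ p) *P q) m                    ≡⟨ coeff-∷* x p q m ⟩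
    x * coeff q m + coeff (shift (p *P q)) m  ≡⟨ cong₂ _+_ (trans (cong (_* coeff q m) (z 0)) (zeroˡ _)) (tail m) ⟩
    0# + 0#                                   ≡⟨ +-identityʳ 0# ⟩
    0#                                        ∎
    where
    tail : ∀ m → coeff (shift (p *P q)) m ≡ 0#
    tail zero    = refl
    tail (suc m) = IsZero-*P p q (λ k → z (suc k)) m

  *P-congʳ : ∀ p {q q′} → q ≈ q′ → p *P q ≈ p *P q′
  *P-congʳ []      e = ≈-refl
  *P-congʳ (x ∷ p) e = +P-cong (scale-cong x e) (shift-cong (*P-congʳ p e))

  *P-congˡ : ∀ {p p′} q → p ≈ p′ → p *P q ≈ p′ *P q
  *P-congˡ {[]}    {[]}      q e       = ≈-refl
  *P-congˡ {[]}    {x′ ∷ p′} q (mk≈ e) = mk≈ λ m → sym (IsZero-*P (x′ ∷ p′) q (λ k → sym (e k)) m)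
  *P-congˡ {x ∷ p} {[]}      q (mk≈ e) = mk≈ (IsZero-*P (x ∷ p) q e)
  *P-congˡ {x ∷ p} {x′ ∷ p′} q (mk≈ e) rewrite e 0 =
    +P-cong ≈-refl (shift-cong (*P-congˡ {p} {p′} q (mk≈ λ m → e (suc m))))

  *P-cong : ∀ {p p′ q q′} → p ≈ p′ → q ≈ q′ → p *P q ≈ p′ *P q′
  *P-cong {p′ = p′} {q = q} e f = ≈-trans (*P-congˡ q e) (*P-congʳ p′ f)

  +P-comm : ∀ p q → p +P q ≈ q +P p
  +P-comm p q = mk≈ λ m → trans (coeff-+ p q m) (trans (+-comm _ _) (sym (coeff-+ q p m)))
    where open CommutativeRing coefficientRing using (+-comm)

  +P-assoc : ∀ p q s → (p +P q) +P s ≈ p +P (q +P s)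
  +P-assoc p q s = mk≈ λ m → begin
    coeff ((p +P q) +P s) m              ≡⟨ trans (coeff-+ (p +P q) s m) (cong (_+ coeff s m) (coeff-+ p q m)) ⟩
    (coeff p m + coeff q m) + coeff s m  ≡⟨ +-assoc _ _ _ ⟩
    coeff p m + (coeff q m + coeff s m)  ≡⟨ sym (trans (coeff-+ p (q +P s) m) (cong (coeff p m +_) (coeff-+ q s m))) ⟩
    coeff (p +P (q +P s)) m              ∎
    where open CommutativeRing coefficientRing using (+-assoc)

  +P-identityʳ : ∀ p → p +P [] ≈ p
  +P-identityʳ p = mk≈ λ m → trans (coeff-+ p [] m) (+-identityʳ _)

  +P-inverseʳ : ∀ p → p +P negate p ≈ []
  +P-inverseʳ p = mk≈ λ m → trans (coeff-- p p m) (-‿inverseʳ _)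

  +P-inverseˡ : ∀ p → negate p +P p ≈ []
  +P-inverseˡ p = ≈-trans (+P-comm (negate p) p) (+P-inverseʳ p)

  *P-zeroʳ : ∀ p → p *P [] ≈ []
  *P-zeroʳ []      = ≈-refl
  *P-zeroʳ (x ∷ p) = mk≈ λ { zero → refl ; (suc m) → ≈⇒≈P (*P-zeroʳ p) m }

  *P-distribˡ : ∀ p q s → p *P (q +P s) ≈ p *P q +P p *P s
  *P-distribˡ []      q s = ≈-refl
  *P-distribˡ (x ∷ p) q s = ≈-trans (+P-cong ≈-refl (shift-cong (*P-distribˡ p q s))) (mk≈ λ m → begin
    coeff (scale x (q +P s) +P shift (p *P q +P p *P s)) m
      ≡⟨ coeff-+ (scale x (q +P s)) _ m ⟩
    coeff (scale x (q +P s)) m + coeff (shift (p *P q +P p *P s)) m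
      ≡⟨ cong₂ _+_ (trans (coeff-scale x (q +P s) m) (cong (x *_) (coeff-+ q s m))) (shift-+ m) ⟩
    x * (coeff q m + coeff s m) + (coeff (shift (p *P q)) m + coeff (shift (p *P s)) m)
      ≡⟨ 𝔽-Solver.solve 5 (λ x a b c d → x :* (a :+ b) :+ (c :+ d) := (x :* a :+ c) :+ (x :* b :+ d)) refl x _ _ _ _ ⟩
    (x * coeff q m + coeff (shift (p *P q)) m) + (x * coeff s m + coeff (shift (p *P s)) m)
      ≡⟨ sym (cong₂ _+_ (coeff-∷* x p q m) (coeff-∷* x p s m)) ⟩
    coeff ((x ∷ p) *P q) m + coeff ((x ∷ p) *P s) m
      ≡⟨ sym (coeff-+ ((x ∷ p) *P q) _ m) ⟩
    coeff ((x ∷ p) *P q +P (x ∷ p) *P s) m ∎)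
    where
    shift-+ : ∀ m → coeff (shift (p *P q +P p *P s)) m ≡ coeff (shift (p *P q)) m + coeff (shift (p *P s)) m
    shift-+ zero    = sym (+-identityˡ 0#)
    shift-+ (suc m) = coeff-+ (p *P q) (p *P s) m

  shift-*P : ∀ p q → shift p *P q ≈ shift (p *P q)
  shift-*P p q = mk≈ λ m → trans (coeff-∷* 0# p q m) (trans (cong (_+ coeff (shift (p *P q)) m) (zeroˡ _)) (+-identityˡ _))

  *P-∷ʳ : ∀ p x q → p *P (x ∷ q) ≈ scale x p +P shift (p *P q)
  *P-∷ʳ []      x q = mk≈ λ { zero → refl ; (suc m) → refl }
  *P-∷ʳ (y ∷ p) x q = ≈-trans (+P-cong (≈-refl {scale y (x ∷ q)}) (shift-cong (*P-∷ʳ p x q))) (mk≈ λ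
    { zero    → trans (+-identityʳ (y * x)) (trans (*-comm y x) (sym (+-identityʳ (x * y))))
    ; (suc m) → begin
        coeff (scale y q +P (scale x p +P shift (p *P q))) m
          ≡⟨ trans (coeff-+ (scale y q) _ m) (cong (coeff (scale y q) m +_) (coeff-+ (scale x p) _ m)) ⟩
        coeff (scale y q) m + (coeff (scale x p) m + coeff (shift (p *P q)) m)
          ≡⟨ 𝔽-Solver.solve 3 (λ a b c → a :+ (b :+ c) := b :+ (a :+ c)) refl _ _ _ ⟩
        coeff (scale x p) m + (coeff (scale y q) m + coeff (shift (p *P q)) m)
          ≡⟨ sym (trans (coeff-+ (scale x p) _ m) (cong (coeff (scale x p) m +_) (coeff-+ (scale y q) _ m))) ⟩
        coeff (scale x p +P (scale y q +P shift (p *P q))) m ∎ })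

  *P-comm : ∀ p q → p *P q ≈ q *P p
  *P-comm []      q = ≈-sym (*P-zeroʳ q)
  *P-comm (x ∷ p) q = ≈-trans (+P-cong ≈-refl (shift-cong (*P-comm p q))) (≈-sym (*P-∷ʳ q x p))

  *P-distribʳ : ∀ s p q → (p +P q) *P s ≈ p *P s +P q *P s
  *P-distribʳ s p q =
    ≈-trans (*P-comm (p +P q) s) (≈-trans (*P-distribˡ s p q) (+P-cong (*P-comm s p) (*P-comm s q)))

  scale-*P : ∀ c p q → scale c p *P q ≈ scale c (p *P q)
  scale-*P c []      q = ≈-refl
  scale-*P c (x ∷ p) q = ≈-trans (+P-cong ≈-refl (shift-cong (scale-*P c p q))) (mk≈ λ m → begin
    coeff (scale (c * x) q +P shift (scale c (p *P q))) m
      ≡⟨ coeff-+ (scale (c * x) q) _ m ⟩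
    coeff (scale (c * x) q) m + coeff (shift (scale c (p *P q))) m
      ≡⟨ cong₂ _+_ (coeff-scale (c * x) q m) (shift-scale m) ⟩
    (c * x) * coeff q m + c * coeff (shift (p *P q)) m
      ≡⟨ 𝔽-Solver.solve 4 (λ c x a b → (c :* x) :* a :+ c :* b := c :* (x :* a :+ b)) refl c x _ _ ⟩
    c * (x * coeff q m + coeff (shift (p *P q)) m)
      ≡⟨ cong (c *_) (sym (coeff-∷* x p q m)) ⟩
    c * coeff ((x ∷ p) *P q) m
      ≡⟨ sym (coeff-scale c ((x ∷ p) *P q) m) ⟩
    coeff (scale c ((x ∷ p) *P q)) m ∎)
    where
    shift-scale : ∀ m → coeff (shift (scale c (p *P q))) m ≡ c * coeff (shift (p *P q)) m
    shift-scale zero    = sym (zeroʳ c)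
    shift-scale (suc m) = coeff-scale c (p *P q) m

  *P-assoc : ∀ p q s → (p *P q) *P s ≈ p *P (q *P s)
  *P-assoc []      q s = ≈-refl
  *P-assoc (x ∷ p) q s = ≈-trans (*P-distribʳ s (scale x q) (shift (p *P q)))
    (+P-cong (scale-*P x q s) (≈-trans (shift-*P (p *P q) s) (shift-cong (*P-assoc p q s))))

  *P-identityˡ : ∀ p → 1P *P p ≈ p
  *P-identityˡ p = mk≈ λ m →
    trans (coeff-∷* 1# [] p m) (trans (cong₂ _+_ (*-identityˡ _) (vanishing m)) (+-identityʳ _))
    where
    vanishing : ∀ m → coeff (shift ([] *P p)) m ≡ 0#
    vanishing zero    = refl
    vanishing (suc m) = refl

  *P-identityʳ : ∀ p → p *P 1P ≈ p
  *P-identityʳ p = ≈-trans (*P-comm p 1P) (*P-identityˡ p)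

  isCommutativeRing-Poly : IsCommutativeRing _≈_ _+P_ _*P_ negate [] 1P
  isCommutativeRing-Poly = record
    { isRing = record
      { +-isAbelianGroup = record
        { isGroup = record
          { isMonoid = record
            { isSemigroup = record
              { isMagma = record
                { isEquivalence = record { refl = ≈-refl ; sym = ≈-sym ; trans = ≈-trans }
                ; ∙-cong = +P-cong }
              ; assoc = +P-assoc }
            ; identity = (λ _ → ≈-refl) , +P-identityʳ }
          ; inverse = +P-inverseˡ , +P-inverseʳ
          ; ⁻¹-cong = negate-cong }
        ; comm = +P-comm }
      ; *-cong = *P-cong
      ; *-assoc = *P-assoc
      ; *-identity = *P-identityˡ , *P-identityʳ
      ; distrib = *P-distribˡ , *P-distribʳ }
    ; *-comm = *P-comm }

  polynomialRing : CommutativeRing 0ℓ 0ℓ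
  polynomialRing = record { isCommutativeRing = isCommutativeRing-Poly }

  module ℙ = CommutativeRing polynomialRing


module PolynomialDegree (F : FiniteField) where

  open import Data.List.Base using ([]; _∷_)
  open import Data.Nat.Base using (ℕ; zero; suc; _≤_; _<_; s≤s) renaming (_+_ to _+ℕ_)
  import Data.Nat.Properties as ℕ
  open import Data.Fin.Properties using () renaming (_≟_ to _≟ᶠ_)
  open import Data.Product.Base using (Σ; _,_; proj₁; proj₂)
  open import Data.Sum.Base using (_⊎_; inj₁; inj₂)
  open import Data.Empty using (⊥-elim)
  open import Function.Bundles using (Inverse; Injection)
  open import Function.Properties.Inverse using (↔⇒↣)
  open import Relation.Binary.Definitions using (tri<; tri≈; tri>)
  open import Relation.Binary.PropositionalEquality
  open import Relation.Nullary using (¬_; Dec; yes; no)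
  import Algebra.Properties.Ring as RingProperties

  open FiniteField F
  open Over F
  open PolynomialRing F
  open ≡-Reasoning

  _≟_ : (x y : Carrier) → Dec (x ≡ y)
  x ≟ y with Inverse.to finite x ≟ᶠ Inverse.to finite y
  ... | yes eq = yes (Injection.injective (↔⇒↣ finite) eq)
  ... | no neq = no (λ x≡y → neq (cong (Inverse.to finite) x≡y))

  *-≢0 : ∀ {x y} → x ≢ 0# → y ≢ 0# → x * y ≢ 0#
  *-≢0 {x} {y} x≢0 y≢0 xy≡0 = y≢0 (begin
    y              ≡⟨ sym (*-identityˡ y) ⟩
    1# * y         ≡⟨ cong (_* y) (sym (proj₂ (inverse x x≢0))) ⟩
    (x * x⁻¹) * y  ≡⟨ *-assoc x x⁻¹ y ⟩
    x * (x⁻¹ * y)  ≡⟨ cong (x *_) (*-comm x⁻¹ y) ⟩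
    x * (y * x⁻¹)  ≡⟨ sym (*-assoc x y x⁻¹) ⟩
    (x * y) * x⁻¹  ≡⟨ cong (_* x⁻¹) xy≡0 ⟩
    0# * x⁻¹       ≡⟨ zeroˡ x⁻¹ ⟩
    0#             ∎)
    where
    x⁻¹ = proj₁ (inverse x x≢0)

  record Degree (p : Poly) (k : ℕ) : Set where
    constructor degree
    field
      leading≢0      : coeff p k ≢ 0#
      vanishes-above : ∀ m → k < m → coeff p m ≡ 0#
  open Degree public

  IsZero⊎Degree : ∀ p → IsZero p ⊎ Σ ℕ (Degree p)
  IsZero⊎Degree []      = inj₁ (λ _ → refl)
  IsZero⊎Degree (x ∷ p) with IsZero⊎Degree p
  ... | inj₂ (k , degree lc≢0 above) = inj₂ (suc k , degree lc≢0 λ { (suc m) (s≤s k<m) → above m k<m })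
  ... | inj₁ p≈0 with x ≟ 0#
  ...   | yes x≡0 = inj₁ λ { zero → x≡0 ; (suc m) → p≈0 m }
  ...   | no  x≢0 = inj₂ (0 , degree x≢0 λ { (suc m) _ → p≈0 m })

  Degree-resp-≈ : ∀ {p q k} → p ≈ q → Degree p k → Degree q k
  Degree-resp-≈ (mk≈ e) (degree lc≢0 above) = degree (λ lc≡0 → lc≢0 (trans (e _) lc≡0)) λ m k<m → trans (sym (e m)) (above m k<m)

  Degree-unique : ∀ {p i j} → Degree p i → Degree p j → i ≡ j
  Degree-unique {i = i} {j} (degree lcᵢ≢0 aboveᵢ) (degree lcⱼ≢0 aboveⱼ) with ℕ.<-cmp i j
  ... | tri< i<j _ _ = ⊥-elim (lcⱼ≢0 (aboveᵢ j i<j))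
  ... | tri≈ _ i≡j _ = i≡j
  ... | tri> _ _ j<i = ⊥-elim (lcᵢ≢0 (aboveⱼ i j<i))

  Degree⇒¬IsZero : ∀ {p k} → Degree p k → ¬ IsZero p
  Degree⇒¬IsZero (degree lc≢0 _) p≈0 = lc≢0 (p≈0 _)

  MonicDeg⇒Degree : ∀ {r n} → MonicDeg r n → Degree r n
  MonicDeg⇒Degree (lc≡1 , above) = degree (λ lc≡0 → 0≢1 (trans (sym lc≡0) lc≡1)) above

  MonicDeg⇒¬IsZero : ∀ {r n} → MonicDeg r n → ¬ IsZero r
  MonicDeg⇒¬IsZero {r} r-monic = Degree⇒¬IsZero (MonicDeg⇒Degree {r} r-monic)

  coeff-*P-vanishing : ∀ p q m → (∀ i j → i +ℕ j ≡ m → coeff p i * coeff q j ≡ 0#) → coeff (p *P q) m ≡ 0#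
  coeff-*P-vanishing []      q m terms≡0 = refl
  coeff-*P-vanishing (x ∷ p) q m terms≡0 =
    trans (coeff-∷* x p q m) (trans (cong₂ _+_ (terms≡0 0 m refl) (tail m (λ i j e → terms≡0 (suc i) j e))) (+-identityʳ 0#))
    where
    tail : ∀ m → (∀ i j → suc (i +ℕ j) ≡ m → coeff p i * coeff q j ≡ 0#) → coeff (shift (p *P q)) m ≡ 0#
    tail zero    _        = refl
    tail (suc m) terms≡0′ = coeff-*P-vanishing p q m (λ i j e → terms≡0′ i j (cong suc e))

  coeff-*P-single : ∀ p q i j → (∀ i′ j′ → i′ +ℕ j′ ≡ i +ℕ j → i′ ≢ i → coeff p i′ * coeff q j′ ≡ 0#) →
                    coeff (p *P q) (i +ℕ j) ≡ coeff p i * coeff q j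
  coeff-*P-single []      q i       j others≡0 = sym (zeroˡ _)
  coeff-*P-single (x ∷ p) q zero    j others≡0 =
    trans (coeff-∷* x p q j) (trans (cong (x * coeff q j +_) (tail j refl)) (+-identityʳ _))
    where
    tail : ∀ m → m ≡ j → coeff (shift (p *P q)) m ≡ 0#
    tail zero    _   = refl
    tail (suc m) m≡j = coeff-*P-vanishing p q m (λ i′ j′ e → others≡0 (suc i′) j′ (trans (cong suc e) m≡j) (λ ()))
  coeff-*P-single (x ∷ p) q (suc i) j others≡0 =
    trans (coeff-∷* x p q (suc (i +ℕ j)))
      (trans (cong₂ _+_ (others≡0 0 _ refl (λ ()))
                        (coeff-*P-single p q i j (λ i′ j′ e i′≢i → others≡0 (suc i′) j′ (cong suc e) (λ e′ → i′≢i (ℕ.suc-injective e′)))))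
        (+-identityˡ _))

  module _ {p q i j} (deg-p : Degree p i) (deg-q : Degree q j) where

    private
      term≡0 : ∀ {i′ j′} → i < i′ ⊎ j < j′ → coeff p i′ * coeff q j′ ≡ 0#
      term≡0 {i′} {j′} (inj₁ i<i′) = trans (cong (_* coeff q j′) (vanishes-above deg-p i′ i<i′)) (zeroˡ _)
      term≡0 {i′} {j′} (inj₂ j<j′) = trans (cong (coeff p i′ *_) (vanishes-above deg-q j′ j<j′)) (zeroʳ _)

      right-larger : ∀ {i′ j′} → i +ℕ j ≤ i′ +ℕ j′ → i′ < i → j < j′
      right-larger {i′} {j′} ij≤i′j′ i′<i = ℕ.+-cancelˡ-< i j j′ (ℕ.≤-<-trans ij≤i′j′ (ℕ.+-monoˡ-< j′ i′<i))

    coeff-*P-leading : coeff (p *P q) (i +ℕ j) ≡ coeff p i * coeff q j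
    coeff-*P-leading = coeff-*P-single p q i j others≡0
      where
      others≡0 : ∀ i′ j′ → i′ +ℕ j′ ≡ i +ℕ j → i′ ≢ i → coeff p i′ * coeff q j′ ≡ 0#
      others≡0 i′ j′ e i′≢i with ℕ.<-cmp i i′
      ... | tri< i<i′ _ _ = term≡0 (inj₁ i<i′)
      ... | tri≈ _ i≡i′ _ = ⊥-elim (i′≢i (sym i≡i′))
      ... | tri> _ _ i′<i = term≡0 (inj₂ (right-larger (ℕ.≤-reflexive (sym e)) i′<i))

    Degree-*P : Degree (p *P q) (i +ℕ j)
    Degree-*P = degree lc≢0 above
      where
      lc≢0 : coeff (p *P q) (i +ℕ j) ≢ 0#
      lc≢0 lc≡0 = *-≢0 (leading≢0 deg-p) (leading≢0 deg-q) (trans (sym coeff-*P-leading) lc≡0)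
      above : ∀ m → i +ℕ j < m → coeff (p *P q) m ≡ 0#
      above m ij<m = coeff-*P-vanishing p q m terms≡0
        where
        terms≡0 : ∀ i′ j′ → i′ +ℕ j′ ≡ m → coeff p i′ * coeff q j′ ≡ 0#
        terms≡0 i′ j′ refl with ℕ.<-cmp i i′
        ... | tri< i<i′ _ _ = term≡0 (inj₁ i<i′)
        ... | tri≈ _ refl _ = term≡0 (inj₂ (ℕ.+-cancelˡ-< i j j′ ij<m))
        ... | tri> _ _ i′<i = term≡0 (inj₂ (right-larger (ℕ.<⇒≤ ij<m) i′<i))

  ¬IsZero-*P : ∀ {p q} → ¬ IsZero p → ¬ IsZero q → ¬ IsZero (p *P q)
  ¬IsZero-*P {p} {q} p≉0 q≉0 with IsZero⊎Degree p | IsZero⊎Degree q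
  ... | inj₁ p≈0       | _              = ⊥-elim (p≉0 p≈0)
  ... | inj₂ _         | inj₁ q≈0       = ⊥-elim (q≉0 q≈0)
  ... | inj₂ (i , deg-p) | inj₂ (j , deg-q) = Degree⇒¬IsZero (Degree-*P deg-p deg-q)

  open RingProperties ℙ.ring using (x∙y⁻¹≈ε⇒x≈y; x≈y⇒x∙y⁻¹≈ε; x[y-z]≈xy-xz)

  *P-cancelˡ : ∀ {r p q} → ¬ IsZero r → r *P p ≈ r *P q → p ≈ q
  *P-cancelˡ {r} {p} {q} r≉0 rp≈rq with IsZero⊎Degree (p -P q)
  ... | inj₁ p-q≈0 = x∙y⁻¹≈ε⇒x≈y p q (mk≈ p-q≈0)
  ... | inj₂ (_ , deg) = ⊥-elim (¬IsZero-*P {r} {p -P q} r≉0 (Degree⇒¬IsZero deg)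
                           (≈⇒≈P (ℙ.trans (x[y-z]≈xy-xz r p q) (x≈y⇒x∙y⁻¹≈ε rp≈rq))))


module PolynomialDivisibility (F : FiniteField) where

  open import Data.List.Base using ([]; _∷_; length)
  open import Data.Nat.Base using (ℕ; zero; suc; _≤_; _<_; z≤n; s≤s) renaming (_+_ to _+ℕ_)
  import Data.Nat.Properties as ℕ
  open import Data.Product.Base using (Σ; _×_; _,_; proj₁)
  open import Data.Sum.Base using (inj₁; inj₂)
  open import Data.Empty using (⊥-elim)
  open import Relation.Binary.PropositionalEquality
  open import Relation.Nullary using (¬_; yes; no)

  open FiniteField F
  open Over F
  open PolynomialRing F
  open PolynomialDegree F
  open RingDivisibility polynomialRing public

  ∣P⇒∣ˡ : ∀ {e p} → e ∣P p → e ∣ˡ p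
  ∣P⇒∣ˡ (m , em≈p) = m , mk≈ em≈p

  ∣ˡ⇒∣P : ∀ {e p} → e ∣ˡ p → e ∣P p
  ∣ˡ⇒∣P (m , mk≈ em≈p) = m , em≈p

  IsZero-*Pʳ : ∀ p {q} → IsZero q → IsZero (p *P q)
  IsZero-*Pʳ p {q} q≈0 = ≈⇒≈P (ℙ.trans (*P-comm p q) (mk≈ {q *P p} {[]} (IsZero-*P q p q≈0)))

  monic-quotient : ∀ {r n r′ n′ m} → MonicDeg r n → MonicDeg r′ n′ → r *P m ≈ r′ →
                   Σ ℕ λ k → MonicDeg m k × n′ ≡ n +ℕ k
  monic-quotient {r} {n} {r′} {n′} {m} r-monic r′-monic rm≈r′ with IsZero⊎Degree m
  ... | inj₁ m≈0 = ⊥-elim (MonicDeg⇒¬IsZero {r′} r′-monic (≈⇒≈P (ℙ.trans (ℙ.sym rm≈r′) (mk≈ {r *P m} {[]} (IsZero-*Pʳ r m≈0)))))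
  ... | inj₂ (k , deg-m) = k , (lc≡1 , vanishes-above deg-m) , n′≡n+k
    where
    deg-r = MonicDeg⇒Degree {r} r-monic
    n′≡n+k : n′ ≡ n +ℕ k
    n′≡n+k = Degree-unique (MonicDeg⇒Degree {r′} r′-monic) (Degree-resp-≈ rm≈r′ (Degree-*P deg-r deg-m))
    lc≡1 : coeff m k ≡ 1#
    lc≡1 = begin
      coeff m k                ≡⟨ sym (*-identityˡ _) ⟩
      1# * coeff m k           ≡⟨ cong (_* coeff m k) (sym (proj₁ r-monic)) ⟩
      coeff r n * coeff m k    ≡⟨ sym (coeff-*P-leading deg-r deg-m) ⟩
      coeff (r *P m) (n +ℕ k)  ≡⟨ ≈⇒≈P rm≈r′ (n +ℕ k) ⟩
      coeff r′ (n +ℕ k)        ≡⟨ cong (coeff r′) (sym n′≡n+k) ⟩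
      coeff r′ n′              ≡⟨ proj₁ r′-monic ⟩
      1#                       ∎
      where open ≡-Reasoning

  MonicDeg0⇒≈1P : ∀ {m} → MonicDeg m 0 → m ≈ 1P
  MonicDeg0⇒≈1P (lc≡1 , above) = mk≈ λ { zero → lc≡1 ; (suc j) → above (suc j) (s≤s z≤n) }

  monic-∣ˡ-antisym : ∀ {r n r′ n′} → MonicDeg r n → MonicDeg r′ n′ → r ∣ˡ r′ → r′ ∣ˡ r → r ≈ r′
  monic-∣ˡ-antisym {r} {n} {r′} {n′} r-monic r′-monic (m , rm≈r′) (m′ , r′m′≈r)
    with monic-quotient {r} {n} {r′} {n′} {m} r-monic r′-monic rm≈r′
       | monic-quotient {r′} {n′} {r} {n} {m′} r′-monic r-monic r′m′≈r
  ... | k , m-monic , n′≡n+k | k′ , _ , n≡n′+k′ =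
    ℙ.trans (ℙ.sym (*P-identityʳ r)) (ℙ.trans (*P-congʳ r (ℙ.sym (MonicDeg0⇒≈1P {m} (subst (MonicDeg m) k≡0 m-monic)))) rm≈r′)
    where
    k≡0 : k ≡ 0
    k≡0 = ℕ.m+n≡0⇒n≡0 k′ (ℕ.+-cancelˡ-≡ n′ (k′ +ℕ k) 0 (begin
      n′ +ℕ (k′ +ℕ k)  ≡⟨ sym (ℕ.+-assoc n′ k′ k) ⟩
      n′ +ℕ k′ +ℕ k    ≡⟨ cong (_+ℕ k) (sym n≡n′+k′) ⟩
      n +ℕ k           ≡⟨ sym n′≡n+k ⟩
      n′               ≡⟨ sym (ℕ.+-identityʳ n′) ⟩
      n′ +ℕ 0          ∎))
      where open ≡-Reasoning

  monic-∣ˡ-1P : ∀ {r n} → MonicDeg r n → r ∣ˡ 1P → r ≈ 1P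
  monic-∣ˡ-1P {r} {n} r-monic r∣1 =
    monic-∣ˡ-antisym {r} {n} {1P} {0} r-monic (refl , λ { (suc m) _ → refl }) r∣1 (r , *P-identityˡ r)

  AbsLt-length : ∀ p → AbsLt p (length p)
  AbsLt-length []      m       _         = refl
  AbsLt-length (x ∷ p) (suc m) (s≤s l≤m) = AbsLt-length p m l≤m

  AbsLt-resp-≈ : ∀ {p q n} → p ≈ q → AbsLt p n → AbsLt q n
  AbsLt-resp-≈ (mk≈ e) p<n m n≤m = trans (sym (e m)) (p<n m n≤m)

  AbsLt-mono : ∀ {p n n′} → n ≤ n′ → AbsLt p n → AbsLt p n′
  AbsLt-mono n≤n′ p<n m n′≤m = p<n m (ℕ.≤-trans n≤n′ n′≤m)

  AbsLt-- : ∀ {p q n} → AbsLt p n → AbsLt q n → AbsLt (p -P q) n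
  AbsLt-- {p} {q} p<n q<n m n≤m = trans (coeff-- p q m) (trans (cong₂ (λ a b → a + - b) (p<n m n≤m) (q<n m n≤m)) (-‿inverseʳ 0#))

  Degree<AbsLt : ∀ {p k N} → Degree p k → AbsLt p N → k < N
  Degree<AbsLt {k = k} {N} deg p<N with k ℕ.<? N
  ... | yes k<N = k<N
  ... | no  k≮N = ⊥-elim (leading≢0 deg (p<N k (ℕ.≮⇒≥ k≮N)))

  MonicDeg⇒AbsLt : ∀ {r n} → MonicDeg r n → AbsLt r (suc n)
  MonicDeg⇒AbsLt (_ , above) = above

  AbsLt-*P : ∀ {p q A B} → AbsLt p A → AbsLt q (suc B) → AbsLt (p *P q) (A +ℕ B)
  AbsLt-*P {p} {q} {A} {B} p<A q<B+1 m A+B≤m = coeff-*P-vanishing p q m terms≡0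
    where
    terms≡0 : ∀ i j → i +ℕ j ≡ m → coeff p i * coeff q j ≡ 0#
    terms≡0 i j i+j≡m with A ℕ.≤? i
    ... | yes A≤i = trans (cong (_* coeff q j) (p<A i A≤i)) (zeroˡ _)
    ... | no  A≰i = trans (cong (coeff p i *_) (q<B+1 j B<j)) (zeroʳ _)
      where
      B<j : B < j
      B<j = ℕ.+-cancelˡ-< i B j (ℕ.<-≤-trans (ℕ.+-monoˡ-< B (ℕ.≰⇒> A≰i)) (ℕ.≤-trans A+B≤m (ℕ.≤-reflexive (sym i+j≡m))))

  AbsLt-*P-cancelˡ : ∀ {e p A} → ¬ IsZero e → AbsLt (e *P p) A → AbsLt p A
  AbsLt-*P-cancelˡ {e} {p} {A} e≉0 ep<A m A≤m with IsZero⊎Degree p | IsZero⊎Degree e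
  ... | inj₁ p≈0         | _                = p≈0 m
  ... | inj₂ _           | inj₁ e≈0         = ⊥-elim (e≉0 e≈0)
  ... | inj₂ (j , deg-p) | inj₂ (i , deg-e) = vanishes-above deg-p m (ℕ.<-≤-trans j<A A≤m)
    where
    j<A : j < A
    j<A = ℕ.≤-<-trans (ℕ.m≤n+m j i) (Degree<AbsLt (Degree-*P deg-e deg-p) ep<A)

  monic-∣ˡ-AbsLt⇒≈[] : ∀ {r n x} → MonicDeg r n → r ∣ˡ x → AbsLt x n → x ≈ []
  monic-∣ˡ-AbsLt⇒≈[] {r} {n} {x} r-monic (m , rm≈x) x<n with IsZero⊎Degree m
  ... | inj₁ m≈0        = ℙ.trans (ℙ.sym rm≈x) (mk≈ {r *P m} {[]} (IsZero-*Pʳ r m≈0))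
  ... | inj₂ (k , deg-m) =
    ⊥-elim (leading≢0 (Degree-resp-≈ rm≈x (Degree-*P (MonicDeg⇒Degree {r} r-monic) deg-m)) (x<n (n +ℕ k) (ℕ.m≤m+n n k)))


module PolynomialGCD (F : FiniteField) where

  open import Data.List.Base using ([]; _∷_; length)
  open import Data.Nat.Base using (ℕ; zero; suc; z≤n; s≤s)
  import Data.Nat.Properties as ℕ
  open import Data.Product.Base using (_,_)
  open import Data.Sum.Base using (inj₁; inj₂)
  open import Relation.Binary.PropositionalEquality
  import Algebra.Solver.Ring.NaturalCoefficients.Default as NatSolver

  open FiniteField F
  open Over F
  open PolynomialRing F
  open PolynomialDegree F
  open PolynomialDivisibility F
  module ℙ-Solver = NatSolver ℙ.commutativeSemiring
  open ℙ-Solver using (_:+_; _:*_; _:=_)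

  ∷-+P : ∀ x p q → x ∷ (p +P q) ≈ shift p +P (x ∷ q)
  ∷-+P x p q = mk≈ λ { zero → sym (+-identityˡ x) ; (suc m) → refl }

  ∷-cong : ∀ x {p q} → p ≈ q → x ∷ p ≈ x ∷ q
  ∷-cong x (mk≈ e) = mk≈ λ { zero → refl ; (suc m) → e m }

  long-division-step : ∀ r q ρ x c → x ∷ (r *P q +P ρ) ≈ r *P (c ∷ q) +P ((x ∷ ρ) -P scale c r)
  long-division-step r q ρ x c = begin
    x ∷ (r *P q +P ρ)                                             ≈⟨ ∷-+P x (r *P q) ρ ⟩
    shift (r *P q) +P (x ∷ ρ)                                     ≈⟨ ℙ.sym (ℙ.+-identityʳ _) ⟩
    (shift (r *P q) +P (x ∷ ρ)) +P []                             ≈⟨ ℙ.+-congˡ {shift (r *P q) +P (x ∷ ρ)} (ℙ.sym (+P-inverseʳ (scale c r))) ⟩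
    (shift (r *P q) +P (x ∷ ρ)) +P (scale c r -P scale c r)
      ≈⟨ ℙ-Solver.solve 4 (λ t X s s′ → (t :+ X) :+ (s :+ s′)
                           := (s :+ t) :+ (X :+ s′)) ℙ.refl (shift (r *P q)) (x ∷ ρ) (scale c r) (negate (scale c r)) ⟩
    (scale c r +P shift (r *P q)) +P ((x ∷ ρ) -P scale c r)       ≈⟨ ℙ.+-congʳ {(x ∷ ρ) -P scale c r} (ℙ.sym (*P-∷ʳ r c q)) ⟩
    r *P (c ∷ q) +P ((x ∷ ρ) -P scale c r)                        ∎
    where open import Relation.Binary.Reasoning.Setoid ℙ.setoid

  AbsLt-reduce : ∀ {r n X} → MonicDeg r n → AbsLt X (suc n) → AbsLt (X -P scale (coeff X n) r) n
  AbsLt-reduce {r} {n} {X} (lc≡1 , r-above) X<n+1 m n≤m =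
    trans (coeff-- X (scale c r) m) (trans (cong (λ s → coeff X m + - s) (coeff-scale c r m)) (cancels m n≤m))
    where
    c = coeff X n
    cancels : ∀ m → n ≤ m → coeff X m + - (c * coeff r m) ≡ 0#
    cancels m n≤m with ℕ.m≤n⇒m<n∨m≡n n≤m
    ... | inj₂ refl = trans (cong (λ s → c + - (c * s)) lc≡1) (trans (cong (λ s → c + - s) (*-identityʳ c)) (-‿inverseʳ c))
    ... | inj₁ n<m  = trans (cong₂ (λ a b → a + - (c * b)) (X<n+1 m n<m) (r-above m n<m))
                        (trans (cong (λ s → 0# + - s) (zeroʳ c)) (trans (cong (0# +_) -0#≈0#) (+-identityʳ 0#)))

  record DivisionWithRemainder (p b : Poly) (n : ℕ) : Set where
    constructor division
    field
      quo rem : Poly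
      p≈bq+r  : p ≈ b *P quo +P rem
      rem<    : AbsLt rem n

  divide-monic : ∀ {r n} → MonicDeg r n → ∀ p → DivisionWithRemainder p r n
  divide-monic {r} {n} r-monic [] = division [] [] (ℙ.sym (ℙ.trans (ℙ.+-identityʳ _) (*P-zeroʳ r))) (λ _ _ → refl)
  divide-monic {r} {n} r-monic (x ∷ p) with divide-monic {r} r-monic p
  ... | division q ρ p≈ ρ<n =
    division (c ∷ q) ((x ∷ ρ) -P scale c r) (ℙ.trans (∷-cong x p≈) (long-division-step r q ρ x c)) (AbsLt-reduce {r} {n} {x ∷ ρ} r-monic x∷ρ<n+1)
    where
    c = coeff (x ∷ ρ) n
    x∷ρ<n+1 : AbsLt (x ∷ ρ) (suc n)
    x∷ρ<n+1 (suc m) (s≤s n≤m) = ρ<n m n≤m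

  scale≈const*P : ∀ c p → scale c p ≈ (c ∷ []) *P p
  scale≈const*P c p = mk≈ λ m → trans (coeff-scale c p m) (sym (trans (coeff-∷* c [] p m) (trans (cong (c * coeff p m +_) (shift-[] m)) (+-identityʳ _))))
    where
    shift-[] : ∀ m → coeff (shift ([] *P p)) m ≡ 0#
    shift-[] zero    = refl
    shift-[] (suc m) = refl

  const-*P : ∀ a b → (a ∷ []) *P (b ∷ []) ≈ (a * b) ∷ []
  const-*P a b = mk≈ λ { zero → +-identityʳ _ ; (suc m) → refl }

  scale-*Pʳ : ∀ c p q → scale c p *P q ≈ p *P scale c q
  scale-*Pʳ c p q = begin
    scale c p *P q         ≈⟨ *P-congˡ q (scale≈const*P c p) ⟩
    ((c ∷ []) *P p) *P q   ≈⟨ ℙ-Solver.solve 3 (λ c p q → (c :* p) :* q := p :* (c :* q)) ℙ.refl (c ∷ []) p q ⟩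
    p *P ((c ∷ []) *P q)   ≈⟨ *P-congʳ p (ℙ.sym (scale≈const*P c q)) ⟩
    p *P scale c q         ∎
    where open import Relation.Binary.Reasoning.Setoid ℙ.setoid

  scale-inverse : ∀ {ℓ i} → ℓ * i ≡ 1# → ∀ p → scale ℓ (scale i p) ≈ p
  scale-inverse {ℓ} {i} ℓi≡1 p = begin
    scale ℓ (scale i p)              ≈⟨ ℙ.trans (scale≈const*P ℓ _) (*P-congʳ (ℓ ∷ []) (scale≈const*P i p)) ⟩
    (ℓ ∷ []) *P ((i ∷ []) *P p)      ≈⟨ ℙ.sym (*P-assoc (ℓ ∷ []) (i ∷ []) p) ⟩
    ((ℓ ∷ []) *P (i ∷ [])) *P p      ≈⟨ *P-congˡ p (const-*P ℓ i) ⟩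
    ((ℓ * i) ∷ []) *P p              ≡⟨ cong (λ c → (c ∷ []) *P p) ℓi≡1 ⟩
    1P *P p                          ≈⟨ *P-identityˡ p ⟩
    p                                ∎
    where open import Relation.Binary.Reasoning.Setoid ℙ.setoid

  scale-MonicDeg : ∀ {q k i} → Degree q k → i * coeff q k ≡ 1# → MonicDeg (scale i q) k
  scale-MonicDeg {q} {k} {i} deg i·lc≡1 =
    trans (coeff-scale i q k) i·lc≡1 , λ m k<m → trans (coeff-scale i q m) (trans (cong (i *_) (vanishes-above deg m k<m)) (zeroʳ i))

  divide : ∀ {b k} → Degree b k → ∀ p → DivisionWithRemainder p b k
  divide {b} {k} deg p with inverse (coeff b k) (leading≢0 deg)
  ... | i , lc·i≡1 with divide-monic {scale i b} {k} (scale-MonicDeg deg (trans (*-comm i _) lc·i≡1)) p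
  ... | division q ρ p≈ ρ<k = division (scale i q) ρ (ℙ.trans p≈ (+P-cong (scale-*Pʳ i b q) ℙ.refl)) ρ<k

  record GCD (a b : Poly) : Set where
    constructor gcd
    field
      g u v    : Poly
      bezout   : g ≈ u *P a +P v *P b
      g∣ˡa     : g ∣ˡ a
      g∣ˡb     : g ∣ˡ b

  gcd-with-zero : ∀ a {b} → IsZero b → GCD a b
  gcd-with-zero a {b} b≈0 =
    gcd a 1P [] (ℙ.sym (ℙ.trans (ℙ.+-identityʳ _) (*P-identityˡ a))) ∣ˡ-refl ([] , ℙ.trans (*P-zeroʳ a) (ℙ.sym (mk≈ {b} {[]} b≈0)))

  euclid : ∀ fuel a b → AbsLt b fuel → GCD a b
  euclid zero       a b b<0 = gcd-with-zero a (λ m → b<0 m z≤n)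
  euclid (suc fuel) a b b<fuel+1 with IsZero⊎Degree b
  ... | inj₁ b≈0       = gcd-with-zero a b≈0
  ... | inj₂ (k , deg) = step (divide deg a)
    where
    step : DivisionWithRemainder a b k → GCD a b
    step (division q ρ a≈bq+ρ ρ<k) = extend (euclid fuel b ρ (AbsLt-mono {ρ} (ℕ.≤-pred (Degree<AbsLt deg b<fuel+1)) ρ<k))
      where
      extend : GCD b ρ → GCD a b
      extend (gcd g u v bezout g∣ˡb g∣ˡρ) =
        gcd g v (u -P v *P q) (bezout-division-step {a} {b} {q} {ρ} {g} {u} {v} a≈bq+ρ bezout)
          (∣ˡ-respʳ-≈ (ℙ.sym a≈bq+ρ) (∣ˡ-+ (x∣ˡy⇒x∣ˡyz q g∣ˡb) g∣ˡρ)) g∣ˡb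

  gcdOf : ∀ a b → GCD a b
  gcdOf a b = euclid (length b) a b (AbsLt-length b)

  bezout⇒Coprime : ∀ {a b u v} → u *P a +P v *P b ≈ 1P → Coprime a b
  bezout⇒Coprime {a} {b} {u} {v} bezout e e∣a e∣b =
    ∣ˡ⇒∣P {e} (∣ˡ-respʳ-≈ bezout (∣ˡ-linear u v (∣P⇒∣ˡ {e} {a} e∣a) (∣P⇒∣ˡ {e} {b} e∣b)))

  record Bezout (a b : Poly) : Set where
    constructor bezout
    field
      u v      : Poly
      identity : u *P a +P v *P b ≈ 1P

  record Bezout₃ (a b r : Poly) : Set where
    constructor bezout₃
    field
      u v w    : Poly
      identity : u *P a +P v *P b +P w *P r ≈ 1P

  Coprime⇒Bezout : ∀ {a b} → Coprime a b → Bezout a b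
  Coprime⇒Bezout {a} {b} coprime with gcdOf a b
  ... | gcd g u v g≈ua+vb g∣ˡa g∣ˡb with ∣P⇒∣ˡ {g} (coprime g (∣ˡ⇒∣P {g} g∣ˡa) (∣ˡ⇒∣P {g} g∣ˡb))
  ... | m , gm≈1 = bezout (m *P u) (m *P v) (begin
    (m *P u) *P a +P (m *P v) *P b  ≈⟨ ℙ-Solver.solve 5 (λ m u a v b → (m :* u) :* a :+ (m :* v) :* b := (u :* a :+ v :* b) :* m) ℙ.refl m u a v b ⟩
    (u *P a +P v *P b) *P m         ≈⟨ *P-congˡ m (ℙ.sym g≈ua+vb) ⟩
    g *P m                          ≈⟨ gm≈1 ⟩
    1P                              ∎)
    where open import Relation.Binary.Reasoning.Setoid ℙ.setoid

  Coprime3⇒Bezout₃ : ∀ {a b r} → Coprime3 a b r → Bezout₃ a b r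
  Coprime3⇒Bezout₃ {a} {b} {r} coprime with gcdOf a b
  ... | gcd g₁ u v g₁≈ua+vb g₁∣ˡa g₁∣ˡb with gcdOf g₁ r
  ... | gcd g x y g≈xg₁+yr g∣ˡg₁ g∣ˡr
    with ∣P⇒∣ˡ {g} (coprime g (∣ˡ⇒∣P {g} (∣ˡ-trans g∣ˡg₁ g₁∣ˡa)) (∣ˡ⇒∣P {g} (∣ˡ-trans g∣ˡg₁ g₁∣ˡb))
                              (∣ˡ⇒∣P {g} g∣ˡr))
  ... | m , gm≈1 = bezout₃ (m *P x *P u) (m *P x *P v) (m *P y) (begin
    (m *P x *P u) *P a +P (m *P x *P v) *P b +P (m *P y) *P r
      ≈⟨ ℙ-Solver.solve 8 (λ m x u a v b y r → (m :* x :* u) :* a :+ (m :* x :* v) :* b :+ (m :* y) :* r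
                           := (x :* (u :* a :+ v :* b) :+ y :* r) :* m) ℙ.refl m x u a v b y r ⟩
    (x *P (u *P a +P v *P b) +P y *P r) *P m  ≈⟨ *P-congˡ m (ℙ.sym (ℙ.trans g≈xg₁+yr (+P-cong (*P-congʳ x g₁≈ua+vb) ℙ.refl))) ⟩
    g *P m                                   ≈⟨ gm≈1 ⟩
    1P                                       ∎)
    where open import Relation.Binary.Reasoning.Setoid ℙ.setoid


module LaurentDigits (F : FiniteField) where

  open import Data.List.Base using ([]; _∷_)
  open import Data.Nat.Base using (ℕ; zero; suc; _≤_; _<_) renaming (_+_ to _+ℕ_)
  import Data.Nat.Properties as ℕ
  open import Data.Product.Base using (_×_; _,_)
  open import Relation.Binary.PropositionalEquality
  import Algebra.Properties.Ring as RingProperties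
  import Algebra.Solver.Ring.NaturalCoefficients.Default as NatSolver

  open FiniteField F
  open Over F
  open PolynomialRing F
  open PolynomialDegree F
  open PolynomialDivisibility F
  open PolynomialGCD F
  open RingProperties ℙ.ring using (x[y-z]≈xy-xz; x∙y⁻¹≈ε⇒x≈y)
  open NatSolver ℙ.commutativeSemiring using (solve; _:+_; _:*_; _:=_)

  shiftN : ℕ → Poly → Poly
  shiftN zero    p = p
  shiftN (suc N) p = shift (shiftN N p)

  coeff-shiftN : ∀ N p m → coeff (shiftN N p) (N +ℕ m) ≡ coeff p m
  coeff-shiftN zero    p m = refl
  coeff-shiftN (suc N) p m = coeff-shiftN N p m

  shiftN-cong : ∀ N {p q} → p ≈ q → shiftN N p ≈ shiftN N q
  shiftN-cong zero    p≈q = p≈q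
  shiftN-cong (suc N) p≈q = shift-cong (shiftN-cong N p≈q)

  shiftN-*P : ∀ N p q → shiftN N p *P q ≈ shiftN N (p *P q)
  shiftN-*P zero    p q = ℙ.refl
  shiftN-*P (suc N) p q = ℙ.trans (shift-*P (shiftN N p) q) (shift-cong (shiftN-*P N p q))

  shiftN≈t^N*P : ∀ N p → shiftN N p ≈ shiftN N 1P *P p
  shiftN≈t^N*P N p = ℙ.sym (ℙ.trans (shiftN-*P N 1P p) (shiftN-cong N (*P-identityˡ p)))

  -- The first N digits of a/r, read as the polynomial Σ_{j<N} digit j · t^(N-1-j).
  leadingDigits : Poly → Poly → ℕ → ℕ → Poly
  leadingDigits a r n zero    = []
  leadingDigits a r n (suc N) = digit a r n N ∷ leadingDigits a r n N

  long-division : ∀ a r n N → shiftN N a ≈ r *P leadingDigits a r n N +P remainder a r n N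
  long-division a r n zero    = ℙ.sym (ℙ.trans (+P-cong (*P-zeroʳ r) ℙ.refl) ℙ.refl)
  long-division a r n (suc N) =
    ℙ.trans (∷-cong 0# (long-division a r n N)) (long-division-step r (leadingDigits a r n N) (remainder a r n N) 0# (digit a r n N))

  AbsLt-remainder : ∀ {a r n} → MonicDeg r n → AbsLt a n → ∀ N → AbsLt (remainder a r n N) n
  AbsLt-remainder r-monic a<n zero    = a<n
  AbsLt-remainder {a} {r} {n} r-monic a<n (suc N) =
    AbsLt-reduce {r} {n} {shift (remainder a r n N)} r-monic λ { (suc m) n<m+1 → AbsLt-remainder r-monic a<n N m (ℕ.≤-pred n<m+1) }

  leadingDigits-cong : ∀ {a r n a′ r′ n′} N → (∀ j → j < N → digit a r n j ≡ digit a′ r′ n′ j) →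
                       leadingDigits a r n N ≡ leadingDigits a′ r′ n′ N
  leadingDigits-cong zero    _      = refl
  leadingDigits-cong (suc N) agree = cong₂ _∷_ (agree N ℕ.≤-refl) (leadingDigits-cong N (λ j j<N → agree j (ℕ.m≤n⇒m≤1+n j<N)))

  -- If t^N a = r Q + ρ and t^N a′ = r′ Q + ρ′, then t^N (a r′ - a′ r) = ρ r′ - ρ′ r has degree < N.
  digits-agree⇒cross-equal : ∀ {a r n a′ r′ n′} N → MonicDeg r n → MonicDeg r′ n′ → AbsLt a n → AbsLt a′ n′ → n +ℕ n′ ≤ N →
                            (∀ j → j < N → digit a r n j ≡ digit a′ r′ n′ j) → a *P r′ ≈ a′ *P r
  digits-agree⇒cross-equal {a} {r} {n} {a′} {r′} {n′} N r-monic r′-monic a<n a′<n′ n+n′≤N agree =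
    x∙y⁻¹≈ε⇒x≈y (a *P r′) (a′ *P r) (mk≈ λ m →
      trans (sym (coeff-shiftN N D m)) (trans (≈⇒≈P shiftD≈ (N +ℕ m)) (small (N +ℕ m) (ℕ.≤-trans n+n′≤N (ℕ.m≤m+n N m)))))
    where
    D = a *P r′ -P a′ *P r
    Q = leadingDigits a r n N
    ρ = remainder a r n N
    ρ′ = remainder a′ r′ n′ N
    a′-division : shiftN N a′ ≈ r′ *P Q +P ρ′
    a′-division = subst (λ Q′ → shiftN N a′ ≈ r′ *P Q′ +P ρ′) (sym (leadingDigits-cong N agree)) (long-division a′ r′ n′ N)
    shiftD≈ : shiftN N D ≈ ρ *P r′ -P ρ′ *P r
    shiftD≈ = begin
      shiftN N D                                            ≈⟨ shiftN≈t^N*P N D ⟩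
      T *P (a *P r′ -P a′ *P r)                             ≈⟨ x[y-z]≈xy-xz T (a *P r′) (a′ *P r) ⟩
      T *P (a *P r′) -P T *P (a′ *P r)                      ≈⟨ ℙ.+-cong (ℙ.sym (*P-assoc T a r′)) (ℙ.-‿cong (ℙ.sym (*P-assoc T a′ r))) ⟩
      (T *P a) *P r′ -P (T *P a′) *P r
        ≈⟨ ℙ.+-cong (*P-congˡ r′ (ℙ.sym (shiftN≈t^N*P N a))) (ℙ.-‿cong (*P-congˡ r (ℙ.sym (shiftN≈t^N*P N a′)))) ⟩
      shiftN N a *P r′ -P shiftN N a′ *P r                  ≈⟨ +-swap⇒-≈ {shiftN N a *P r′} {shiftN N a′ *P r} {ρ′ *P r} {ρ *P r′} cross ⟩
      ρ *P r′ -P ρ′ *P r                                    ∎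
      where
      open import Relation.Binary.Reasoning.Setoid ℙ.setoid
      T = shiftN N 1P
      cross : shiftN N a *P r′ +P ρ′ *P r ≈ ρ *P r′ +P shiftN N a′ *P r
      cross = begin
        shiftN N a *P r′ +P ρ′ *P r           ≈⟨ ℙ.+-congʳ (*P-congˡ r′ (long-division a r n N)) ⟩
        (r *P Q +P ρ) *P r′ +P ρ′ *P r        ≈⟨ solve 5 (λ r Q ρ r′ ρ′ → (r :* Q :+ ρ) :* r′ :+ ρ′ :* r
                                                          := ρ :* r′ :+ (r′ :* Q :+ ρ′) :* r) ℙ.refl r Q ρ r′ ρ′ ⟩
        ρ *P r′ +P (r′ *P Q +P ρ′) *P r       ≈⟨ ℙ.+-congˡ (*P-congˡ r (ℙ.sym a′-division)) ⟩
        ρ *P r′ +P shiftN N a′ *P r           ∎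
    small : AbsLt (ρ *P r′ -P ρ′ *P r) (n +ℕ n′)
    small = AbsLt-- {ρ *P r′} {ρ′ *P r} (AbsLt-*P {ρ} {r′} (AbsLt-remainder r-monic a<n N) (MonicDeg⇒AbsLt {r′} r′-monic))
              (subst (AbsLt (ρ′ *P r)) (ℕ.+-comm n′ n) (AbsLt-*P {ρ′} {r} (AbsLt-remainder r′-monic a′<n′ N) (MonicDeg⇒AbsLt {r} r-monic)))

  cross-equal⇒same-fraction : ∀ {r n a₁ a₂ r′ n′ a₁′ a₂′} → MonicDeg r n → MonicDeg r′ n′ →
                              Coprime3 a₁ a₂ r → Coprime3 a₁′ a₂′ r′ → a₁ *P r′ ≈ a₁′ *P r → a₂ *P r′ ≈ a₂′ *P r →
                              r ≈ r′ × a₁ ≈ a₁′ × a₂ ≈ a₂′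
  cross-equal⇒same-fraction {r} {n} {a₁} {a₂} {r′} {n′} {a₁′} {a₂′} r-monic r′-monic coprime coprime′ e₁ e₂ =
    r≈r′ , cancel {a₁} {a₁′} e₁ , cancel {a₂} {a₂′} e₂
    where
    ∣ˡ-other-denominator : ∀ {r a₁ a₂ r′ a₁′ a₂′} → Coprime3 a₁ a₂ r →
                           a₁ *P r′ ≈ a₁′ *P r → a₂ *P r′ ≈ a₂′ *P r → r ∣ˡ r′
    ∣ˡ-other-denominator {r} {a₁} {a₂} {r′} {a₁′} {a₂′} coprime e₁ e₂ = use (Coprime3⇒Bezout₃ coprime)
      where
      multiple : ∀ {a a′} → a *P r′ ≈ a′ *P r → r ∣ˡ r′ *P a
      multiple {a} {a′} e = a′ , ℙ.trans (*P-comm r a′) (ℙ.trans (ℙ.sym e) (*P-comm a r′))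
      use : Bezout₃ a₁ a₂ r → r ∣ˡ r′
      use (bezout₃ u v w identity) =
        bezout₃⇒∣ˡ-cancel {a₁} {a₂} {r} {r′} {u} {v} {w} identity (multiple {a₁} {a₁′} e₁) (multiple {a₂} {a₂′} e₂)
    r≈r′ : r ≈ r′
    r≈r′ = monic-∣ˡ-antisym {r} {n} {r′} {n′} r-monic r′-monic
             (∣ˡ-other-denominator {r} {a₁} {a₂} {r′} {a₁′} {a₂′} coprime e₁ e₂)
             (∣ˡ-other-denominator {r′} {a₁′} {a₂′} {r} {a₁} {a₂} coprime′ (ℙ.sym e₁) (ℙ.sym e₂))
    cancel : ∀ {a a′} → a *P r′ ≈ a′ *P r → a ≈ a′
    cancel {a} {a′} e = *P-cancelˡ {r} (MonicDeg⇒¬IsZero {r} r-monic)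
      (ℙ.trans (*P-comm r a) (ℙ.trans (*P-congʳ a r≈r′) (ℙ.trans e (*P-comm a′ r))))


module DirectionUniqueness (F : FiniteField) where

  open import Data.List.Base using ([])
  open import Data.Nat.Base using (ℕ; _≤_; _<_) renaming (_+_ to _+ℕ_; _*_ to _*ℕ_)
  import Data.Nat.Properties as ℕ
  open import Data.Product.Base using (_×_; _,_; proj₁; proj₂)
  open import Data.Sum.Base using (inj₁; inj₂)
  open import Data.Empty using (⊥-elim)
  open import Relation.Binary.PropositionalEquality
  open import Relation.Nullary using (¬_; yes; no)
  import Algebra.Properties.Ring as RingProperties
  import Data.Nat.Solver
  import Algebra.Solver.Ring.NaturalCoefficients.Default as NatSolver

  open FiniteField F
  open Over F
  open PolynomialRing F
  open PolynomialDegree F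
  open PolynomialDivisibility F
  open PolynomialGCD F
  open RingProperties ℙ.ring using (x∙y⁻¹≈ε⇒x≈y)

  -- |p| ≤ T̂ |r|^{1/2} and |p| < T̂⁻¹ |r|^{1/2} respectively, where n = deg r, in the form used by Admissible₁.
  Short₁ Short₂ : ℕ → ℕ → ℕ → Poly → Set
  Short₁ R₁ R₂ n p = ∀ m → R₁ +ℕ n < R₂ +ℕ 2 *ℕ m → coeff p m ≡ 0#
  Short₂ R₁ R₂ n p = ∀ m → R₂ +ℕ n ≤ R₁ +ℕ 2 *ℕ m → coeff p m ≡ 0#

  short-exponents : ∀ R₁ R₂ n i j → n ≤ i +ℕ j → R₂ +ℕ 2 *ℕ i ≤ R₁ +ℕ n → R₂ +ℕ n ≤ R₁ +ℕ 2 *ℕ j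
  short-exponents R₁ R₂ n i j n≤i+j i-large = ℕ.+-cancelʳ-≤ (2 *ℕ i +ℕ n) (R₂ +ℕ n) (R₁ +ℕ 2 *ℕ j) (begin
    (R₂ +ℕ n) +ℕ (2 *ℕ i +ℕ n)               ≡⟨ solve 3 (λ R₂ n i → (R₂ :+ n) :+ (con 2 :* i :+ n) := (R₂ :+ con 2 :* i) :+ (n :+ n)) refl R₂ n i ⟩
    (R₂ +ℕ 2 *ℕ i) +ℕ (n +ℕ n)               ≤⟨ ℕ.+-mono-≤ i-large (ℕ.+-mono-≤ n≤i+j n≤i+j) ⟩
    (R₁ +ℕ n) +ℕ ((i +ℕ j) +ℕ (i +ℕ j))      ≡⟨ solve 4 (λ R₁ n i j → (R₁ :+ n) :+ ((i :+ j) :+ (i :+ j))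
                                                         := (R₁ :+ con 2 :* j) :+ (con 2 :* i :+ n)) refl R₁ n i j ⟩
    (R₁ +ℕ 2 *ℕ j) +ℕ (2 *ℕ i +ℕ n)          ∎)
    where
    open ℕ.≤-Reasoning
    open Data.Nat.Solver.+-*-Solver using (solve; _:+_; _:*_; _:=_; con)

  Short₁*Short₂-AbsLt : ∀ {R₁ R₂ n p q} → Short₁ R₁ R₂ n p → Short₂ R₁ R₂ n q → AbsLt (p *P q) n
  Short₁*Short₂-AbsLt {R₁} {R₂} {n} {p} {q} p-short q-short m n≤m = coeff-*P-vanishing p q m terms≡0
    where
    terms≡0 : ∀ i j → i +ℕ j ≡ m → coeff p i * coeff q j ≡ 0#
    terms≡0 i j i+j≡m with (R₁ +ℕ n) ℕ.<? (R₂ +ℕ 2 *ℕ i)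
    ... | yes i-large = trans (cong (_* coeff q j) (p-short i i-large)) (zeroˡ _)
    ... | no  i-small = trans (cong (coeff p i *_) (q-short j (short-exponents R₁ R₂ n i j (subst (n ≤_) (sym i+j≡m) n≤m) (ℕ.≮⇒≥ i-small)))) (zeroʳ _)

  -- Two short vectors orthogonal to (a₁, a₂) modulo r have a determinant divisible by r and smaller than r.
  short-orthogonal⇒det≈0 : ∀ {R₁ R₂ r n a₁ a₂ v₁ v₂ w₁ w₂} → MonicDeg r n → Coprime3 a₁ a₂ r →
    r ∣ˡ v₁ *P a₁ +P v₂ *P a₂ → r ∣ˡ w₁ *P a₁ +P w₂ *P a₂ →
    Short₁ R₁ R₂ n v₁ → Short₂ R₁ R₂ n v₂ → Short₁ R₁ R₂ n w₁ → Short₂ R₁ R₂ n w₂ → v₁ *P w₂ ≈ v₂ *P w₁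
  short-orthogonal⇒det≈0 {R₁} {R₂} {r} {n} {a₁} {a₂} {v₁} {v₂} {w₁} {w₂} r-monic coprime r∣v·a r∣w·a
                         v₁-short v₂-short w₁-short w₂-short =
    x∙y⁻¹≈ε⇒x≈y (v₁ *P w₂) (v₂ *P w₁) (monic-∣ˡ-AbsLt⇒≈[] {r} {n} r-monic (r∣det (Coprime3⇒Bezout₃ coprime)) det<n)
    where
    r∣det : Bezout₃ a₁ a₂ r → r ∣ˡ v₁ *P w₂ -P v₂ *P w₁
    r∣det (bezout₃ u v w identity) = bezout₃⇒∣ˡ-det {a₁} {a₂} {r} {u} {v} {w} {v₁} {v₂} {w₁} {w₂} identity r∣v·a r∣w·a
    det<n : AbsLt (v₁ *P w₂ -P v₂ *P w₁) n
    det<n = AbsLt-- {v₁ *P w₂} {v₂ *P w₁} (Short₁*Short₂-AbsLt {R₁} {R₂} {n} {v₁} {w₂} v₁-short w₂-short)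
              (AbsLt-resp-≈ (*P-comm w₁ v₂) (Short₁*Short₂-AbsLt {R₁} {R₂} {n} {w₁} {v₂} w₁-short v₂-short))

  Coprime-IsZero⇒≈1P : ∀ {c₁ c₂ n} → Coprime c₁ c₂ → IsZero c₁ → MonicDeg c₂ n → c₂ ≈ 1P
  Coprime-IsZero⇒≈1P {c₁} {c₂} {n} coprime c₁≈0 c₂-monic =
    monic-∣ˡ-1P {c₂} {n} c₂-monic (∣P⇒∣ˡ {c₂} (coprime c₂ c₂∣c₁ (∣ˡ⇒∣P {c₂} (∣ˡ-refl {c₂}))))
    where
    c₂∣c₁ : c₂ ∣P c₁
    c₂∣c₁ = ∣ˡ⇒∣P {c₂} ([] , ℙ.trans (*P-zeroʳ c₂) (ℙ.sym (mk≈ {c₁} {[]} c₁≈0)))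

  Primitive-unique : ∀ {c₁ c₂ c₁′ c₂′} → Primitive c₁ c₂ → Primitive c₁′ c₂′ →
                     c₁ *P c₂′ ≈ c₂ *P c₁′ → c₁ ≈ c₁′ × c₂ ≈ c₂′
  Primitive-unique {c₁} {c₂} {c₁′} {c₂′} (coprime , inj₁ (n₁ , c₁-monic)) (coprime′ , inj₁ (n₁′ , c₁′-monic)) c₁c₂′≈c₂c₁′ =
    c₁≈c₁′ , c₂≈c₂′
    where
    divides : ∀ {c₁ c₂ c₁′ c₂′} → Coprime c₁ c₂ → c₁ *P c₂′ ≈ c₂ *P c₁′ → c₁ ∣ˡ c₁′
    divides {c₁} {c₂} {c₁′} {c₂′} coprime e = use (Coprime⇒Bezout coprime)
      where
      use : Bezout c₁ c₂ → c₁ ∣ˡ c₁′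
      use (bezout u v identity) = bezout⇒∣ˡ-cancel {c₁} {c₂} {c₁′} {u} {v} identity (c₂′ , e)
    c₁≈c₁′ : c₁ ≈ c₁′
    c₁≈c₁′ = monic-∣ˡ-antisym {c₁} {n₁} {c₁′} {n₁′} c₁-monic c₁′-monic (divides {c₁} {c₂} {c₁′} {c₂′} coprime c₁c₂′≈c₂c₁′)
      (divides {c₁′} {c₂′} {c₁} {c₂} coprime′ (ℙ.trans (*P-comm c₁′ c₂) (ℙ.trans (ℙ.sym c₁c₂′≈c₂c₁′) (*P-comm c₁ c₂′))))
    c₂≈c₂′ : c₂ ≈ c₂′
    c₂≈c₂′ = ℙ.sym (*P-cancelˡ {c₁} (MonicDeg⇒¬IsZero {c₁} c₁-monic)
                      (ℙ.trans c₁c₂′≈c₂c₁′ (ℙ.trans (*P-congʳ c₂ (ℙ.sym c₁≈c₁′)) (*P-comm c₂ c₁))))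
  Primitive-unique {c₁} {c₂} {c₁′} {c₂′} (_ , inj₁ (_ , c₁-monic)) (_ , inj₂ (c₁′≈0 , _ , c₂′-monic)) c₁c₂′≈c₂c₁′ =
    ⊥-elim (MonicDeg⇒¬IsZero {c₂′} c₂′-monic (≈⇒≈P (*P-cancelˡ {c₁} (MonicDeg⇒¬IsZero {c₁} c₁-monic)
      (ℙ.trans c₁c₂′≈c₂c₁′ (ℙ.trans (mk≈ {c₂ *P c₁′} {[]} (IsZero-*Pʳ c₂ c₁′≈0)) (ℙ.sym (*P-zeroʳ c₁)))))))
  Primitive-unique {c₁} {c₂} {c₁′} {c₂′} (_ , inj₂ (c₁≈0 , _ , c₂-monic)) (_ , inj₁ (_ , c₁′-monic)) c₁c₂′≈c₂c₁′ =
    ⊥-elim (MonicDeg⇒¬IsZero {c₂} c₂-monic (≈⇒≈P (*P-cancelˡ {c₁′} (MonicDeg⇒¬IsZero {c₁′} c₁′-monic)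
      (ℙ.trans (*P-comm c₁′ c₂) (ℙ.trans (ℙ.sym c₁c₂′≈c₂c₁′)
        (ℙ.trans (mk≈ {c₁ *P c₂′} {[]} (IsZero-*P c₁ c₂′ c₁≈0)) (ℙ.sym (*P-zeroʳ c₁′))))))))
  Primitive-unique {c₁} {c₂} {c₁′} {c₂′} (coprime , inj₂ (c₁≈0 , _ , c₂-monic)) (coprime′ , inj₂ (c₁′≈0 , _ , c₂′-monic)) _ =
    ℙ.trans (mk≈ {c₁} {[]} c₁≈0) (ℙ.sym (mk≈ {c₁′} {[]} c₁′≈0)) ,
    ℙ.trans (Coprime-IsZero⇒≈1P {c₁} {c₂} coprime c₁≈0 c₂-monic)
            (ℙ.sym (Coprime-IsZero⇒≈1P {c₁′} {c₂′} coprime′ c₁′≈0 c₂′-monic))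

  denominator-unique : ∀ {r d d′ k k′ s nd nd′} → ¬ IsZero r → MonicDeg d nd → MonicDeg d′ nd′ →
                       r *P k ≈ d *P s → r *P k′ ≈ d′ *P s → Coprime k d → Coprime k′ d′ → d ≈ d′
  denominator-unique {r} {d} {d′} {k} {k′} {s} {nd} {nd′} r≉0 d-monic d′-monic rk≈ds rk′≈d′s coprime coprime′ =
    monic-∣ˡ-antisym {d} {nd} {d′} {nd′} d-monic d′-monic
      (divides {d} {d′} {k} {k′} coprime (ℙ.sym d′k≈dk′)) (divides {d′} {d} {k′} {k} coprime′ d′k≈dk′)
    where
    open import Relation.Binary.Reasoning.Setoid ℙ.setoid
    open NatSolver ℙ.commutativeSemiring using (solve; _:*_; _:=_)
    d′k≈dk′ : d′ *P k ≈ d *P k′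
    d′k≈dk′ = *P-cancelˡ {r} r≉0 (begin
      r *P (d′ *P k)  ≈⟨ solve 3 (λ r d′ k → r :* (d′ :* k) := d′ :* (r :* k)) ℙ.refl r d′ k ⟩
      d′ *P (r *P k)  ≈⟨ *P-congʳ d′ rk≈ds ⟩
      d′ *P (d *P s)  ≈⟨ solve 3 (λ d′ d s → d′ :* (d :* s) := d :* (d′ :* s)) ℙ.refl d′ d s ⟩
      d *P (d′ *P s)  ≈⟨ *P-congʳ d (ℙ.sym rk′≈d′s) ⟩
      d *P (r *P k′)  ≈⟨ solve 3 (λ d r k′ → d :* (r :* k′) := r :* (d :* k′)) ℙ.refl d r k′ ⟩
      r *P (d *P k′)  ∎)
    divides : ∀ {d d′ k k′} → Coprime k d → d *P k′ ≈ d′ *P k → d ∣ˡ d′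
    divides {d} {d′} {k} {k′} coprime dk′≈d′k = use (Coprime⇒Bezout coprime)
      where
      use : Bezout k d → d ∣ˡ d′
      use (bezout u v identity) = bezout⇒∣ˡ-cancel {d} {k} {d′} {v} {u} (ℙ.trans (+P-comm (v *P d) (u *P k)) identity)
        (k′ , ℙ.trans dk′≈d′k (*P-comm d′ k))

  InL⇒∣ˡ : ∀ {d c₁ c₂ a₁ a₂ r} → InL d c₁ c₂ a₁ a₂ r → r ∣ˡ (d *P c₁) *P a₁ +P (d *P c₂) *P a₂
  InL⇒∣ˡ {d} {c₁} {c₂} {a₁} {a₂} {r} (k , rk≈ , _) =
    k , ℙ.trans (mk≈ rk≈) (solve 5 (λ d c₁ a₁ c₂ a₂ → d :* (c₁ :* a₁ :+ c₂ :* a₂) := (d :* c₁) :* a₁ :+ (d :* c₂) :* a₂)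
                                  ℙ.refl d c₁ a₁ c₂ a₂)
    where open NatSolver ℙ.commutativeSemiring using (solve; _:+_; _:*_; _:=_)

  short-direction-unique : ∀ {R₁ R₂ r n a₁ a₂ d c₁ c₂ d′ c₁′ c₂′} → MonicDeg r n → Coprime3 a₁ a₂ r →
    IsMonic d  → Primitive c₁ c₂    → Short₁ R₁ R₂ n (d *P c₁)   → Short₂ R₁ R₂ n (d *P c₂)   → InL d c₁ c₂ a₁ a₂ r →
    IsMonic d′ → Primitive c₁′ c₂′  → Short₁ R₁ R₂ n (d′ *P c₁′) → Short₂ R₁ R₂ n (d′ *P c₂′) → InL d′ c₁′ c₂′ a₁ a₂ r →
    d ≈ d′ × c₁ ≈ c₁′ × c₂ ≈ c₂′
  short-direction-unique {R₁} {R₂} {r} {n} {a₁} {a₂} {d} {c₁} {c₂} {d′} {c₁′} {c₂′} r-monic coprime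
    (nd , d-monic) c-primitive short₁ short₂ inL (nd′ , d′-monic) c′-primitive short₁′ short₂′ inL′ =
    d≈d′ , c≈c′
    where
    open import Relation.Binary.Reasoning.Setoid ℙ.setoid
    open NatSolver ℙ.commutativeSemiring using (solve; _:+_; _:*_; _:=_)
    det≈0 : (d *P c₁) *P (d′ *P c₂′) ≈ (d *P c₂) *P (d′ *P c₁′)
    det≈0 = short-orthogonal⇒det≈0 {R₁} {R₂} {r} {n} {a₁} {a₂} {d *P c₁} {d *P c₂} {d′ *P c₁′} {d′ *P c₂′} r-monic coprime
      (InL⇒∣ˡ {d} {c₁} {c₂} {a₁} {a₂} {r} inL) (InL⇒∣ˡ {d′} {c₁′} {c₂′} {a₁} {a₂} {r} inL′) short₁ short₂ short₁′ short₂′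
    c₁c₂′≈c₂c₁′ : c₁ *P c₂′ ≈ c₂ *P c₁′
    c₁c₂′≈c₂c₁′ = *P-cancelˡ {d *P d′} (¬IsZero-*P {d} {d′} (MonicDeg⇒¬IsZero {d} d-monic) (MonicDeg⇒¬IsZero {d′} d′-monic)) (begin
      (d *P d′) *P (c₁ *P c₂′)    ≈⟨ solve 4 (λ d d′ c₁ c₂′ → (d :* d′) :* (c₁ :* c₂′) := (d :* c₁) :* (d′ :* c₂′)) ℙ.refl d d′ c₁ c₂′ ⟩
      (d *P c₁) *P (d′ *P c₂′)    ≈⟨ det≈0 ⟩
      (d *P c₂) *P (d′ *P c₁′)    ≈⟨ solve 4 (λ d c₂ d′ c₁′ → (d :* c₂) :* (d′ :* c₁′) := (d :* d′) :* (c₂ :* c₁′)) ℙ.refl d c₂ d′ c₁′ ⟩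
      (d *P d′) *P (c₂ *P c₁′)    ∎)
    c≈c′ : c₁ ≈ c₁′ × c₂ ≈ c₂′
    c≈c′ = Primitive-unique {c₁} {c₂} {c₁′} {c₂′} c-primitive c′-primitive c₁c₂′≈c₂c₁′
    s = c₁ *P a₁ +P c₂ *P a₂
    d≈d′ : d ≈ d′
    d≈d′ = denominator-unique {r} {d} {d′} {proj₁ inL} {proj₁ inL′} {s} {nd} {nd′} (MonicDeg⇒¬IsZero {r} r-monic) d-monic d′-monic
      (mk≈ (proj₁ (proj₂ inL)))
      (ℙ.trans (mk≈ (proj₁ (proj₂ inL′)))
               (*P-congʳ d′ (+P-cong (*P-congˡ a₁ (ℙ.sym (proj₁ c≈c′))) (*P-congˡ a₂ (ℙ.sym (proj₂ c≈c′))))))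
      (proj₂ (proj₂ inL)) (proj₂ (proj₂ inL′))


module DirectionExistence (F : FiniteField) where

  open import Data.List.Base using ([]; _∷_)
  open import Data.Vec.Base using (Vec; []; _∷_; _++_; toList; tabulate; lookup; take; drop; splitAt)
  import Data.Vec.Properties as Vec
  open import Data.Fin.Base using (toℕ; fromℕ<)
  import Data.Fin.Properties as Fin
  import Data.Nat.Properties as ℕ
  open import Data.Nat.Base using (ℕ; suc; _<_) renaming (_+_ to _+ℕ_)
  open import Data.Product.Base using (Σ; ∃₂; _×_; _,_; proj₂)
  open import Data.Sum.Base using (_⊎_; inj₁; inj₂)
  open import Data.Empty using (⊥-elim)
  open import Relation.Binary.PropositionalEquality
  open import Relation.Nullary using (¬_; yes; no)
  import Algebra.Solver.Ring.NaturalCoefficients.Default as NatSolver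
  import Algebra.Properties.Ring as RingProperties

  open FiniteField F
  open Over F
  open PolynomialRing F
  open PolynomialDegree F
  open PolynomialDivisibility F
  open PolynomialGCD F
  open VecPigeonhole finite using (vec-pigeonhole; distinct⇒1<size)
  open RingProperties ℙ.ring using (x∙y⁻¹≈ε⇒x≈y)
  open NatSolver ℙ.commutativeSemiring using (solve; _:+_; _:*_; _:=_)

  record CoprimeFactorisation (a b : Poly) : Set where
    constructor factorisation
    field
      g q₁ q₂ : Poly
      g≉0     : ¬ IsZero g
      gq₁≈a   : g *P q₁ ≈ a
      gq₂≈b   : g *P q₂ ≈ b
      coprime : Bezout q₁ q₂

  coprimeFactorisation : ∀ a b → ¬ (IsZero a × IsZero b) → CoprimeFactorisation a b
  coprimeFactorisation a b a,b≉0 = from-gcd (gcdOf a b)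
    where
    from-gcd : GCD a b → CoprimeFactorisation a b
    from-gcd (gcd g u v g≈ua+vb (q₁ , gq₁≈a) (q₂ , gq₂≈b)) =
      factorisation g q₁ q₂ g≉0 gq₁≈a gq₂≈b (bezout u v (*P-cancelˡ {g} g≉0 (begin
        g *P (u *P q₁ +P v *P q₂)          ≈⟨ solve 5 (λ g u q₁ v q₂ → g :* (u :* q₁ :+ v :* q₂)
                                                       := u :* (g :* q₁) :+ v :* (g :* q₂)) ℙ.refl g u q₁ v q₂ ⟩
        u *P (g *P q₁) +P v *P (g *P q₂)   ≈⟨ +P-cong (*P-congʳ u gq₁≈a) (*P-congʳ v gq₂≈b) ⟩
        u *P a +P v *P b                   ≈⟨ ℙ.sym g≈ua+vb ⟩
        g                                  ≈⟨ ℙ.sym (*P-identityʳ g) ⟩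
        g *P 1P                            ∎)))
      where
      open import Relation.Binary.Reasoning.Setoid ℙ.setoid
      g≉0 : ¬ IsZero g
      g≉0 g≈0 = a,b≉0 (≈⇒≈P (ℙ.trans (ℙ.sym gq₁≈a) (mk≈ {g *P q₁} {[]} (IsZero-*P g q₁ g≈0))) ,
                        ≈⇒≈P (ℙ.trans (ℙ.sym gq₂≈b) (mk≈ {g *P q₂} {[]} (IsZero-*P g q₂ g≈0))))

  scale-*P-scale : ∀ {ℓ i} → ℓ * i ≡ 1# → ∀ p q → scale ℓ p *P scale i q ≈ p *P q
  scale-*P-scale {ℓ} {i} ℓi≡1 p q = begin
    scale ℓ p *P scale i q     ≈⟨ scale-*Pʳ ℓ p (scale i q) ⟩
    p *P scale ℓ (scale i q)   ≈⟨ *P-congʳ p (scale-inverse ℓi≡1 q) ⟩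
    p *P q                     ∎
    where open import Relation.Binary.Reasoning.Setoid ℙ.setoid

  rescale : ∀ {a b ℓ i} → ℓ * i ≡ 1# → CoprimeFactorisation a b → CoprimeFactorisation a b
  rescale {ℓ = ℓ} {i} ℓi≡1 (factorisation g q₁ q₂ g≉0 gq₁≈a gq₂≈b (bezout u v identity)) =
    factorisation (scale ℓ g) (scale i q₁) (scale i q₂) ℓg≉0
      (ℙ.trans (scale-*P-scale ℓi≡1 g q₁) gq₁≈a) (ℙ.trans (scale-*P-scale ℓi≡1 g q₂) gq₂≈b)
      (bezout (scale ℓ u) (scale ℓ v) (ℙ.trans (+P-cong (scale-*P-scale ℓi≡1 u q₁) (scale-*P-scale ℓi≡1 v q₂)) identity))
    where
    ℓ≢0 : ℓ ≢ 0#
    ℓ≢0 ℓ≡0 = 0≢1 (trans (sym (zeroˡ i)) (trans (cong (_* i) (sym ℓ≡0)) ℓi≡1))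
    ℓg≉0 : ¬ IsZero (scale ℓ g)
    ℓg≉0 ℓg≈0 with IsZero⊎Degree g
    ... | inj₁ g≈0         = g≉0 g≈0
    ... | inj₂ (k , deg-g) = *-≢0 ℓ≢0 (leading≢0 deg-g) (trans (sym (coeff-scale ℓ g k)) (ℓg≈0 k))

  Degree⇒monic-scale : ∀ {q k} → Degree q k → Σ Carrier λ i → coeff q k * i ≡ 1# × MonicDeg (scale i q) k
  Degree⇒monic-scale {q} {k} deg with inverse (coeff q k) (leading≢0 deg)
  ... | i , lc·i≡1 = i , lc·i≡1 , scale-MonicDeg deg (trans (*-comm i _) lc·i≡1)

  IsZero-scale : ∀ c p → IsZero p → IsZero (scale c p)
  IsZero-scale c p p≈0 m = trans (coeff-scale c p m) (trans (cong (c *_) (p≈0 m)) (zeroʳ c))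

  record PrimitivePart (v₁ v₂ : Poly) : Set where
    constructor primitivePart
    field
      h c₁ c₂     : Poly
      h≉0         : ¬ IsZero h
      hc₁≈v₁      : h *P c₁ ≈ v₁
      hc₂≈v₂      : h *P c₂ ≈ v₂
      c-primitive : Primitive c₁ c₂

  CoprimeFactorisation⇒PrimitivePart : ∀ {v₁ v₂} (cf : CoprimeFactorisation v₁ v₂) → let open CoprimeFactorisation cf in
    IsMonic q₁ ⊎ (IsZero q₁ × IsMonic q₂) → PrimitivePart v₁ v₂
  CoprimeFactorisation⇒PrimitivePart (factorisation h c₁ c₂ h≉0 hc₁≈v₁ hc₂≈v₂ (bezout u v identity)) normalised =
    primitivePart h c₁ c₂ h≉0 hc₁≈v₁ hc₂≈v₂ (bezout⇒Coprime {c₁} {c₂} {u} {v} identity , normalised)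

  primitivePartOf : ∀ v₁ v₂ → ¬ (IsZero v₁ × IsZero v₂) → PrimitivePart v₁ v₂
  primitivePartOf v₁ v₂ v≉0 = normalise (coprimeFactorisation v₁ v₂ v≉0)
    where
    normalise : CoprimeFactorisation v₁ v₂ → PrimitivePart v₁ v₂
    normalise cf@(factorisation g q₁ q₂ _ _ _ _) with IsZero⊎Degree q₁ | IsZero⊎Degree q₂
    ... | inj₂ (k , deg₁) | _ with Degree⇒monic-scale deg₁
    ...   | i , ℓi≡1 , monic = CoprimeFactorisation⇒PrimitivePart (rescale ℓi≡1 cf) (inj₁ (k , monic))
    normalise cf@(factorisation g q₁ q₂ _ _ _ _) | inj₁ q₁≈0 | inj₂ (k , deg₂) with Degree⇒monic-scale deg₂
    ...   | i , ℓi≡1 , monic = CoprimeFactorisation⇒PrimitivePart (rescale ℓi≡1 cf) (inj₂ (IsZero-scale i q₁ q₁≈0 , k , monic))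
    normalise (factorisation _ q₁ q₂ _ _ _ (bezout u v identity)) | inj₁ q₁≈0 | inj₁ q₂≈0 =
      ⊥-elim (0≢1 (begin
        0#                                      ≡⟨ sym (+-identityʳ 0#) ⟩
        0# + 0#                                 ≡⟨ cong₂ _+_ (sym (IsZero-*Pʳ u q₁≈0 0)) (sym (IsZero-*Pʳ v q₂≈0 0)) ⟩
        coeff (u *P q₁) 0 + coeff (v *P q₂) 0   ≡⟨ sym (coeff-+ (u *P q₁) (v *P q₂) 0) ⟩
        coeff (u *P q₁ +P v *P q₂) 0            ≡⟨ ≈⇒≈P identity 0 ⟩
        1#                                      ∎))
      where open ≡-Reasoning

  record ReducedDenominator (r s h : Poly) : Set where
    constructor reducedDenominator
    field
      d       : Poly
      d-monic : IsMonic d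
      d∣r     : d ∣P r
      lowest  : Σ Poly λ k → (r *P k) ≈P (d *P s) × Coprime k d
      d∣h     : d ∣ˡ h

  reducedDenominator-of : ∀ {r n s h} → MonicDeg r n → r ∣ˡ h *P s → ReducedDenominator r s h
  reducedDenominator-of {r} {n} {s} {h} r-monic (M , rM≈hs) = normalise (coprimeFactorisation r s (λ (r≈0 , _) → r≉0 r≈0))
    where
    r≉0 = MonicDeg⇒¬IsZero {r} r-monic
    from : (cf : CoprimeFactorisation r s) → IsMonic (CoprimeFactorisation.q₁ cf) → ReducedDenominator r s h
    from (factorisation g d k g≉0 gd≈r gk≈s (bezout u v identity)) d-monic =
      reducedDenominator d d-monic (g , ≈⇒≈P (ℙ.trans (*P-comm d g) gd≈r))
        (k , ≈⇒≈P rk≈ds , bezout⇒Coprime {k} {d} {v} {u} (ℙ.trans (+P-comm (v *P k) (u *P d)) identity))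
        (bezout⇒∣ˡ-cancel {d} {k} {h} {u} {v} identity (M , dM≈kh))
      where
      open import Relation.Binary.Reasoning.Setoid ℙ.setoid
      rk≈ds : r *P k ≈ d *P s
      rk≈ds = begin
        r *P k          ≈⟨ *P-congˡ k (ℙ.sym gd≈r) ⟩
        (g *P d) *P k   ≈⟨ solve 3 (λ g d k → (g :* d) :* k := d :* (g :* k)) ℙ.refl g d k ⟩
        d *P (g *P k)   ≈⟨ *P-congʳ d gk≈s ⟩
        d *P s          ∎
      dM≈kh : d *P M ≈ k *P h
      dM≈kh = *P-cancelˡ {g} g≉0 (begin
        g *P (d *P M)   ≈⟨ ℙ.sym (*P-assoc g d M) ⟩
        (g *P d) *P M   ≈⟨ *P-congˡ M gd≈r ⟩
        r *P M          ≈⟨ rM≈hs ⟩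
        h *P s          ≈⟨ *P-congʳ h (ℙ.sym gk≈s) ⟩
        h *P (g *P k)   ≈⟨ solve 3 (λ h g k → h :* (g :* k) := g :* (k :* h)) ℙ.refl h g k ⟩
        g *P (k *P h)   ∎)
    normalise : CoprimeFactorisation r s → ReducedDenominator r s h
    normalise cf@(factorisation g q₁ q₂ _ gq₁≈r _ _) with IsZero⊎Degree q₁
    ... | inj₁ q₁≈0 = ⊥-elim (r≉0 (≈⇒≈P (ℙ.trans (ℙ.sym gq₁≈r) (mk≈ {g *P q₁} {[]} (IsZero-*Pʳ g q₁≈0)))))
    ... | inj₂ (k , deg) with Degree⇒monic-scale deg
    ...   | i , ℓi≡1 , monic = from (rescale ℓi≡1 cf) (k , monic)

  record ShortVector (r a₁ a₂ : Poly) (A B : ℕ) : Set where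
    constructor shortVector
    field
      v₁ v₂  : Poly
      v≉0    : ¬ (IsZero v₁ × IsZero v₂)
      v₁<A   : AbsLt v₁ A
      v₂<B   : AbsLt v₂ B
      r∣ˡv·a : r ∣ˡ v₁ *P a₁ +P v₂ *P a₂

  toList-≈-injective : ∀ {k} (x y : Vec Carrier k) → toList x ≈ toList y → x ≡ y
  toList-≈-injective []      []      _          = refl
  toList-≈-injective (a ∷ x) (b ∷ y) (mk≈ x≈y) = cong₂ _∷_ (x≈y 0) (toList-≈-injective x y (mk≈ λ m → x≈y (suc m)))

  AbsLt-toList : ∀ {k} (x : Vec Carrier k) → AbsLt (toList x) k
  AbsLt-toList {k} x = subst (AbsLt (toList x)) (Vec.length-toList x) (AbsLt-length (toList x))

  module _ {r n} (r-monic : MonicDeg r n) where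

    residueOf : ∀ {p} → DivisionWithRemainder p r n → Vec Carrier n
    residueOf (division _ ρ _ _) = tabulate λ t → coeff ρ (toℕ t)

    residue : Poly → Vec Carrier n
    residue p = residueOf (divide-monic r-monic p)

    same-residue⇒∣ˡ- : ∀ {p q} (dp : DivisionWithRemainder p r n) (dq : DivisionWithRemainder q r n) →
                       residueOf dp ≡ residueOf dq → r ∣ˡ p -P q
    same-residue⇒∣ˡ- {p} {q} (division Qp ρp p≈ ρp<n) (division Qq ρq q≈ ρq<n) same =
      ∣ˡ-difference {r} {p} {q} {r *P Qq} {r *P Qp} p+rQq≈rQp+q (x∣ˡxy r Qq) (x∣ˡxy r Qp)
      where
      ρp≈ρq : ρp ≈ ρq
      ρp≈ρq = mk≈ λ m → coefficient m
        where
        coefficient : ∀ m → coeff ρp m ≡ coeff ρq m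
        coefficient m with m ℕ.<? n
        ... | yes m<n = begin
          coeff ρp m                                          ≡⟨ cong (coeff ρp) (sym (Fin.toℕ-fromℕ< m<n)) ⟩
          coeff ρp (toℕ (fromℕ< m<n))                          ≡⟨ sym (Vec.lookup∘tabulate _ (fromℕ< m<n)) ⟩
          lookup (residueOf (division Qp ρp p≈ ρp<n)) (fromℕ< m<n) ≡⟨ cong (λ v → lookup v (fromℕ< m<n)) same ⟩
          lookup (residueOf (division Qq ρq q≈ ρq<n)) (fromℕ< m<n) ≡⟨ Vec.lookup∘tabulate _ (fromℕ< m<n) ⟩
          coeff ρq (toℕ (fromℕ< m<n))                          ≡⟨ cong (coeff ρq) (Fin.toℕ-fromℕ< m<n) ⟩
          coeff ρq m                                          ∎
          where open ≡-Reasoning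
        ... | no  m≮n = trans (ρp<n m (ℕ.≮⇒≥ m≮n)) (sym (ρq<n m (ℕ.≮⇒≥ m≮n)))
      p+rQq≈rQp+q : p +P r *P Qq ≈ r *P Qp +P q
      p+rQq≈rQp+q = begin
        p +P r *P Qq                 ≈⟨ ℙ.+-congʳ p≈ ⟩
        (r *P Qp +P ρp) +P r *P Qq   ≈⟨ solve 3 (λ a ρ b → (a :+ ρ) :+ b := a :+ (b :+ ρ)) ℙ.refl (r *P Qp) ρp (r *P Qq) ⟩
        r *P Qp +P (r *P Qq +P ρp)   ≈⟨ +P-cong (ℙ.refl {r *P Qp}) (+P-cong (ℙ.refl {r *P Qq}) ρp≈ρq) ⟩
        r *P Qp +P (r *P Qq +P ρq)   ≈⟨ ℙ.+-congˡ (ℙ.sym q≈) ⟩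
        r *P Qp +P q                 ∎
        where open import Relation.Binary.Reasoning.Setoid ℙ.setoid

    -- Dirichlet's pigeonhole argument: q^(A+B) choices of (x₁, x₂) but only q^n residues modulo r.
    shortVectorOf : ∀ a₁ a₂ {A B} → n < A +ℕ B → ShortVector r a₁ a₂ A B
    shortVectorOf a₁ a₂ {A} {B} n<A+B = fromCollision (vec-pigeonhole (distinct⇒1<size 0≢1) n<A+B (λ x → residue (combination x)))
      where
      combination : Vec Carrier (A +ℕ B) → Poly
      combination x = toList (take A x) *P a₁ +P toList (drop A x) *P a₂
      fromCollision : ∃₂ (λ x y → x ≢ y × residue (combination x) ≡ residue (combination y)) → ShortVector r a₁ a₂ A B
      fromCollision (x , y , x≢y , same) = shortVector v₁ v₂ v≉0
        (AbsLt-- {toList x₁} {toList y₁} (AbsLt-toList x₁) (AbsLt-toList y₁))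
        (AbsLt-- {toList x₂} {toList y₂} (AbsLt-toList x₂) (AbsLt-toList y₂))
        (∣ˡ-respʳ-≈ (ℙ.sym (linear-difference (toList x₁) (toList y₁) (toList x₂) (toList y₂) a₁ a₂))
          (same-residue⇒∣ˡ- (divide-monic r-monic (combination x)) (divide-monic r-monic (combination y)) same))
        where
        x₁ = take A x
        x₂ = drop A x
        y₁ = take A y
        y₂ = drop A y
        v₁ = toList x₁ -P toList y₁
        v₂ = toList x₂ -P toList y₂
        v≉0 : ¬ (IsZero v₁ × IsZero v₂)
        v≉0 (v₁≈0 , v₂≈0) = x≢y (begin
          x          ≡⟨ proj₂ (proj₂ (splitAt A x)) ⟩
          x₁ ++ x₂   ≡⟨ cong₂ _++_ (toList-≈-injective x₁ y₁ (x∙y⁻¹≈ε⇒x≈y (toList x₁) (toList y₁) (mk≈ v₁≈0)))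
                                   (toList-≈-injective x₂ y₂ (x∙y⁻¹≈ε⇒x≈y (toList x₂) (toList y₂) (mk≈ v₂≈0))) ⟩
          y₁ ++ y₂   ≡⟨ sym (proj₂ (proj₂ (splitAt A y))) ⟩
          y          ∎)
          where open ≡-Reasoning


module Rectangles (F : FiniteField) where

  open import Data.List.Base using ([])
  open import Data.Nat.Base using (_<_) renaming (_+_ to _+ℕ_)
  import Data.Nat.Properties as ℕ
  open import Data.Product.Base using (proj₁; proj₂)
  open import Data.Empty using (⊥)
  open import Function.Bundles using (mk⇔)
  open import Relation.Binary.PropositionalEquality
  open import Relation.Nullary using (¬_)
  import Algebra.Solver.Ring.NaturalCoefficients.Default as NatSolver

  open FiniteField F
  open Over F
  open PolynomialRing F
  open PolynomialDegree F
  open PolynomialDivisibility F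
  open PolynomialGCD F
  open LaurentDigits F
  open DirectionUniqueness F
  open DirectionExistence F
  open Exponents using (ExponentSplit; exponentSplit)

  shared-point⇒same-fraction : ∀ {R₁ R₂ r n a₁ a₂ r′ n′ a₁′ a₂′ θ} → R₂ ≤ R₁ →
    Admissible₂ R₂ (idx₂ r n a₁ a₂) → Admissible₂ R₂ (idx₂ r′ n′ a₁′ a₂′) →
    InRect R₁ R₂ θ a₁ a₂ r n → InRect R₁ R₂ θ a₁′ a₂′ r′ n′ → r ≈ r′ × a₁ ≈ a₁′ × a₂ ≈ a₂′
  shared-point⇒same-fraction {R₁} {R₂} {r} {n} {a₁} {a₂} {r′} {n′} {a₁′} {a₂′} R₂≤R₁
    (r-monic , n≤R₂ , a₁<n , a₂<n , coprime) (r′-monic , n′≤R₂ , a₁′<n′ , a₂′<n′ , coprime′)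
    (close₁ , close₂) (close₁′ , close₂′) =
    cross-equal⇒same-fraction {r} {n} {a₁} {a₂} {r′} {n′} {a₁′} {a₂′} r-monic r′-monic coprime coprime′
      (digits-agree⇒cross-equal {a₁} {r} {n} {a₁′} {r′} {n′} (n +ℕ n′) r-monic r′-monic a₁<n a₁′<n′ ℕ.≤-refl
        (agree close₁ close₁′ (ℕ.≤-trans n′≤R₂ R₂≤R₁) (ℕ.≤-trans n≤R₂ R₂≤R₁)))
      (digits-agree⇒cross-equal {a₂} {r} {n} {a₂′} {r′} {n′} (n +ℕ n′) r-monic r′-monic a₂<n a₂′<n′ ℕ.≤-refl
        (agree close₂ close₂′ n′≤R₂ n≤R₂))
    where
    agree : ∀ {θ a a′ R} → Close θ a r n (n +ℕ R) → Close θ a′ r′ n′ (n′ +ℕ R) → n′ ≤ R → n ≤ R →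
            ∀ j → j < n +ℕ n′ → digit a r n j ≡ digit a′ r′ n′ j
    agree {R = R} close close′ n′≤R n≤R j j<n+n′ =
      trans (sym (close j (ℕ.<-≤-trans j<n+n′ (ℕ.+-monoʳ-≤ n n′≤R))))
            (close′ j (ℕ.<-≤-trans j<n+n′ (ℕ.≤-trans (ℕ.≤-reflexive (ℕ.+-comm n n′)) (ℕ.+-monoʳ-≤ n′ n≤R))))

  disjoint₂ : ∀ {R₁ R₂} → R₂ ≤ R₁ → Disjoint₂ R₁ R₂
  disjoint₂ R₂≤R₁ (idx₂ r n a₁ a₂) (idx₂ r′ n′ a₁′ a₂′) admissible admissible′ distinct θ (in-rect , in-rect′) =
    conclude (shared-point⇒same-fraction {r = r} {n} {a₁} {a₂} {r′} {n′} {a₁′} {a₂′} R₂≤R₁ admissible admissible′ in-rect in-rect′)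
    where
    conclude : r ≈ r′ × a₁ ≈ a₁′ × a₂ ≈ a₂′ → ⊥
    conclude (r≈r′ , a₁≈a₁′ , a₂≈a₂′) = distinct (≈⇒≈P r≈r′ , ≈⇒≈P a₁≈a₁′ , ≈⇒≈P a₂≈a₂′)

  InL-resp-≈ : ∀ {d c₁ c₂ a₁ a₂ r a₁′ a₂′ r′} → r ≈ r′ → a₁ ≈ a₁′ → a₂ ≈ a₂′ →
               InL d c₁ c₂ a₁′ a₂′ r′ → InL d c₁ c₂ a₁ a₂ r
  InL-resp-≈ {d} {c₁} {c₂} {a₁} {a₂} {r} {a₁′} {a₂′} {r′} r≈r′ a₁≈a₁′ a₂≈a₂′ (k , r′k≈ , coprime) =
    k , ≈⇒≈P (ℙ.trans (*P-congˡ k r≈r′) (ℙ.trans (mk≈ r′k≈)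
                (*P-congʳ d (+P-cong (*P-congʳ c₁ (ℙ.sym a₁≈a₁′)) (*P-congʳ c₂ (ℙ.sym a₂≈a₂′)))))) ,
    coprime

  disjoint₁ : ∀ {R₁ R₂} → R₂ ≤ R₁ → Disjoint₁ R₁ R₂
  disjoint₁ {R₁} {R₂} R₂≤R₁ (idx₁ r n d c₁ c₂ a₁ a₂) (idx₁ r′ n′ d′ c₁′ c₂′ a₁′ a₂′)
    (r-monic , n≤R₂ , d-monic , _ , c-primitive , short₁ , short₂ , a₁<n , a₂<n , coprime , inL)
    (r′-monic , n′≤R₂ , d′-monic , _ , c′-primitive , short₁′ , short₂′ , a₁′<n′ , a₂′<n′ , coprime′ , inL′)
    distinct θ (in-rect , in-rect′) =
    conclude (shared-point⇒same-fraction {r = r} {n} {a₁} {a₂} {r′} {n′} {a₁′} {a₂′} R₂≤R₁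
                (r-monic , n≤R₂ , a₁<n , a₂<n , coprime) (r′-monic , n′≤R₂ , a₁′<n′ , a₂′<n′ , coprime′) in-rect in-rect′)
    where
    conclude : r ≈ r′ × a₁ ≈ a₁′ × a₂ ≈ a₂′ → ⊥
    conclude (r≈r′ , a₁≈a₁′ , a₂≈a₂′) =
      distinct (≈⇒≈P r≈r′ , ≈⇒≈P (proj₁ same-direction) , ≈⇒≈P (proj₁ (proj₂ same-direction)) ,
                ≈⇒≈P (proj₂ (proj₂ same-direction)) , ≈⇒≈P a₁≈a₁′ , ≈⇒≈P a₂≈a₂′)
      where
      n′≡n : n′ ≡ n
      n′≡n = Degree-unique (MonicDeg⇒Degree {r′} r′-monic) (Degree-resp-≈ r≈r′ (MonicDeg⇒Degree {r} r-monic))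
      same-direction : d ≈ d′ × c₁ ≈ c₁′ × c₂ ≈ c₂′
      same-direction = short-direction-unique {R₁} {R₂} {r} {n} {a₁} {a₂} {d} {c₁} {c₂} {d′} {c₁′} {c₂′} r-monic coprime
        d-monic c-primitive short₁ short₂ inL d′-monic c′-primitive
        (subst (λ k → Short₁ R₁ R₂ k (d′ *P c₁′)) n′≡n short₁′) (subst (λ k → Short₂ R₁ R₂ k (d′ *P c₂′)) n′≡n short₂′)
        (InL-resp-≈ {d′} {c₁′} {c₂′} {a₁} {a₂} {r} r≈r′ a₁≈a₁′ a₂≈a₂′ inL′)

  record Direction (R₁ R₂ : ℕ) (r : Poly) (n : ℕ) (a₁ a₂ : Poly) : Set where
    constructor direction
    field
      d c₁ c₂     : Poly
      d-monic     : IsMonic d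
      d∣r         : d ∣P r
      c-primitive : Primitive c₁ c₂
      short₁      : Short₁ R₁ R₂ n (d *P c₁)
      short₂      : Short₂ R₁ R₂ n (d *P c₂)
      inL         : InL d c₁ c₂ a₁ a₂ r

  -- The primitive part c of a short vector v orthogonal to a modulo r, with d the reduced denominator of c·a / r.
  directionOf : ∀ {R₁ R₂ r n a₁ a₂} → R₂ ≤ R₁ → MonicDeg r n → Direction R₁ R₂ r n a₁ a₂
  directionOf {R₁} {R₂} {r} {n} {a₁} {a₂} R₂≤R₁ r-monic = fromShortVector (shortVectorOf r-monic a₁ a₂ n<A+B)
    where
    open ExponentSplit (exponentSplit n R₂≤R₁)
    fromShortVector : ShortVector r a₁ a₂ A B → Direction R₁ R₂ r n a₁ a₂
    fromShortVector (shortVector v₁ v₂ v≉0 v₁<A v₂<B r∣v·a) = fromPrimitivePart (primitivePartOf v₁ v₂ v≉0)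
      where
      fromPrimitivePart : PrimitivePart v₁ v₂ → Direction R₁ R₂ r n a₁ a₂
      fromPrimitivePart (primitivePart h c₁ c₂ h≉0 hc₁≈v₁ hc₂≈v₂ c-primitive) =
        fromDenominator (reducedDenominator-of r-monic (∣ˡ-respʳ-≈ v·a≈h[c·a] r∣v·a))
        where
        open NatSolver ℙ.commutativeSemiring using (solve; _:+_; _:*_; _:=_)
        v·a≈h[c·a] : v₁ *P a₁ +P v₂ *P a₂ ≈ h *P (c₁ *P a₁ +P c₂ *P a₂)
        v·a≈h[c·a] = ℙ.trans (+P-cong (*P-congˡ a₁ (ℙ.sym hc₁≈v₁)) (*P-congˡ a₂ (ℙ.sym hc₂≈v₂)))
          (solve 5 (λ h c₁ a₁ c₂ a₂ → (h :* c₁) :* a₁ :+ (h :* c₂) :* a₂ := h :* (c₁ :* a₁ :+ c₂ :* a₂)) ℙ.refl h c₁ a₁ c₂ a₂)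
        fromDenominator : ReducedDenominator r (c₁ *P a₁ +P c₂ *P a₂) h → Direction R₁ R₂ r n a₁ a₂
        fromDenominator (reducedDenominator d d-monic d∣r lowest (e , de≈h)) =
          direction d c₁ c₂ d-monic d∣r c-primitive
            (λ m large → dc< c₁ v₁ hc₁≈v₁ v₁<A m (A-short m large))
            (λ m large → dc< c₂ v₂ hc₂≈v₂ v₂<B m (B-short m large))
            lowest
          where
          e≉0 : ¬ IsZero e
          e≉0 e≈0 = h≉0 (≈⇒≈P (ℙ.trans (ℙ.sym de≈h) (mk≈ {d *P e} {[]} (IsZero-*Pʳ d e≈0))))
          -- |d c| ≤ |h c| = |v| since d divides h.
          dc< : ∀ c v {K} → h *P c ≈ v → AbsLt v K → AbsLt (d *P c) K
          dc< c v {K} hc≈v v<K = AbsLt-*P-cancelˡ {e} {d *P c} {K} e≉0 (AbsLt-resp-≈ (begin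
            v                ≈⟨ ℙ.sym hc≈v ⟩
            h *P c           ≈⟨ *P-congˡ c (ℙ.sym de≈h) ⟩
            (d *P e) *P c    ≈⟨ solve 3 (λ d e c → (d :* e) :* c := e :* (d :* c)) ℙ.refl d e c ⟩
            e *P (d *P c)    ∎) v<K)
            where open import Relation.Binary.Reasoning.Setoid ℙ.setoid

  union⇔ : ∀ {R₁ R₂} → R₂ ≤ R₁ → ∀ θ → Union₁ R₁ R₂ θ ⇔ Union₂ R₁ R₂ θ
  union⇔ {R₁} {R₂} R₂≤R₁ θ = mk⇔ forget extend
    where
    forget : Union₁ R₁ R₂ θ → Union₂ R₁ R₂ θ
    forget (idx₁ r n _ _ _ a₁ a₂ , (r-monic , n≤R₂ , _ , _ , _ , _ , _ , a₁<n , a₂<n , coprime , _) , in-rect) =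
      idx₂ r n a₁ a₂ , (r-monic , n≤R₂ , a₁<n , a₂<n , coprime) , in-rect
    extend : Union₂ R₁ R₂ θ → Union₁ R₁ R₂ θ
    extend (idx₂ r n a₁ a₂ , (r-monic , n≤R₂ , a₁<n , a₂<n , coprime) , in-rect) = from (directionOf R₂≤R₁ r-monic)
      where
      from : Direction R₁ R₂ r n a₁ a₂ → Union₁ R₁ R₂ θ
      from (direction d c₁ c₂ d-monic d∣r c-primitive short₁ short₂ inL) =
        idx₁ r n d c₁ c₂ a₁ a₂ , (r-monic , n≤R₂ , d-monic , d∣r , c-primitive , short₁ , short₂ , a₁<n , a₂<n , coprime , inL) , in-rect


open Rectangles using (disjoint₁; disjoint₂; union⇔)

corollary2p11 : (F : FiniteField) (R₁ R₂ : ℕ) → R₂ ≤ R₁ → 1 ≤ R₂ →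
    let open Over F in
    Disjoint₁ R₁ R₂ × Disjoint₂ R₁ R₂ × (∀ θ → Union₁ R₁ R₂ θ ⇔ Union₂ R₁ R₂ θ)
corollary2p11 F R₁ R₂ R₂≤R₁ _ = disjoint₁ F R₂≤R₁ , disjoint₂ F R₂≤R₁ , union⇔ F R₂≤R₁
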